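{- Let $G=(V,E,<)$ be an ordered graph, with $V$ partitioned into intervals $A_1<\dots<A_m<B_1<\dots<B_m$ of $<$, such that every edge lies between $A_i$ and $B_i$ for some $i$, and for every $i$ the ordered induced subgraph $(A_i\cup B_i,E,<)$ has twin-width at most $k$. Then $\mathsf{tww}(G)\le 2k+2$.
   Context: An ordered graph $(V,E,<)$ is a graph with a linear order $<$ on its vertices; $X<Y$ for sets means every element of $X$ is smaller than every element of $Y$. Twin-width of ordered graphs (viewed as binary structures with relations $E$ and $<$): two vertex sets $X,Y$ are non-homogeneous if for one of the relations $R\in\{E,<\}$ there are $x_1,x_2\in X$, $y_1,y_2\in Y$ with $(x_1,y_1)\in R$ and $(x_2,y_2)\notin R$, or $(y_1,x_1)\in R$ and $(y_2,x_2)\notin R$ (equivalently: $X,Y$ are homogeneous iff they are fully adjacent or fully non-adjacent and $X<Y$ or $Y<X$). For a partition $\mathcal{P}$ of $V$, the error graph has parts as vertices, two distinct parts adjacent iff non-homogeneous; the error degree is its maximum degree. A contraction sequence goes from the singleton partition to $\{V\}$ by merging two parts at each step; its width is the maximum error degree; the twin-width is the minimum width of a contraction sequence. -}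

module Defs where

open import Data.Nat.Base using (ℕ; _≤_; _<ᵇ_; _+_; _*_)
open import Data.Bool.Base using (Bool; true; false; _∧_; _∨_; not; if_then_else_)
open import Data.Fin.Base using (Fin; toℕ; _↑ˡ_; _↑ʳ_)
open import Data.Fin.Properties using (_≟_)
open import Data.List.Base using (List; length; filterᵇ; allFin)
open import Data.Bool.ListAction using (any)
open import Data.Product.Base using (Σ; ∃; _×_)
open import Relation.Nullary.Decidable.Core using (⌊_⌋)
open import Relation.Binary.PropositionalEquality.Core using (_≡_; _≢_)

-- The linear order < is the natural order of Fin n (every finite linear
-- order is isomorphic to one of these).  The edge relation is a Bool-valued
-- relation E, required (where used) to be symmetric and irreflexive.

module _ {n : ℕ} where

  _==_ : Fin n → Fin n → Bool
  a == b = ⌊ a ≟ b ⌋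

  ltᵇ : Fin n → Fin n → Bool
  ltᵇ u v = toℕ u <ᵇ toℕ v

  verts : List (Fin n)
  verts = allFin n

  anyV : (Fin n → Bool) → Bool
  anyV p = any p verts

  viol : (Fin n → Fin n → Bool) → Fin n → Fin n → Fin n → Fin n → Bool
  viol R p q r s = R p q ∧ not (R r s)

-- Partitions of a vertex subset S (given by its characteristic function)
-- are represented by labellings cls : Fin n → Fin n; the parts are the
-- nonempty sets { v ∈ S | cls v ≡ a }.  Values of cls outside S are
-- irrelevant.  All notions below are relative to the structure induced on S
-- (the induced ordered subgraph (S, E, <)).

module TwinWidth {n : ℕ} (S : Fin n → Bool) (E : Fin n → Fin n → Bool) where

  Labelling : Set
  Labelling = Fin n → Fin n

  inPart : Labelling → Fin n → Fin n → Bool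
  inPart cls a v = S v ∧ (cls v == a)

  occurs : Labelling → Fin n → Bool
  occurs cls a = anyV (inPart cls a)

  nonHom : Labelling → Fin n → Fin n → Bool
  nonHom cls a b =
    anyV λ x₁ → anyV λ x₂ → anyV λ y₁ → anyV λ y₂ →
      inPart cls a x₁ ∧ inPart cls a x₂ ∧ inPart cls b y₁ ∧ inPart cls b y₂ ∧
      (viol E x₁ y₁ x₂ y₂ ∨ viol E y₁ x₁ y₂ x₂ ∨
       viol ltᵇ x₁ y₁ x₂ y₂ ∨ viol ltᵇ y₁ x₁ y₂ x₂)

  errDeg : Labelling → Fin n → ℕ
  errDeg cls a =
    length (filterᵇ (λ b → occurs cls b ∧ not (a == b) ∧ nonHom cls a b) verts)

  ErrDegAtMost : ℕ → Labelling → Set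
  ErrDegAtMost d cls = ∀ a → occurs cls a ≡ true → errDeg cls a ≤ d

  Singletons : Labelling → Set
  Singletons cls = ∀ u v → S u ≡ true → S v ≡ true → cls u ≡ cls v → u ≡ v

  Whole : Labelling → Set
  Whole cls = ∀ u v → S u ≡ true → S v ≡ true → cls u ≡ cls v

  MergeStep : Labelling → Labelling → Set
  MergeStep cls cls' =
    Σ (Fin n) λ a → Σ (Fin n) λ b →
      a ≢ b × occurs cls a ≡ true × occurs cls b ≡ true ×
      (∀ v → S v ≡ true → cls' v ≡ (if cls v == b then a else cls v))

  data SeqFrom (d : ℕ) : Labelling → Set where
    done : ∀ cls → ErrDegAtMost d cls → Whole cls → SeqFrom d cls
    step : ∀ cls cls' → ErrDegAtMost d cls → MergeStep cls cls' →
           SeqFrom d cls' → SeqFrom d cls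

  TwwAtMost : ℕ → Set
  TwwAtMost d = Σ Labelling λ cls → Singletons cls × SeqFrom d cls

twwInducedAtMost : {n : ℕ} → (Fin n → Bool) → (Fin n → Fin n → Bool) → ℕ → Set
twwInducedAtMost S E d = TwinWidth.TwwAtMost S E d

twwAtMost : {n : ℕ} → (Fin n → Fin n → Bool) → ℕ → Set
twwAtMost E d = TwinWidth.TwwAtMost (λ _ → true) E d

-- Block structure: blk : Fin n → Fin (m + m) assigns each vertex to one of
-- the 2m blocks A₁,…,Aₘ,B₁,…,Bₘ; block Aᵢ has index i ↑ˡ m, block Bᵢ has
-- index m ↑ʳ i, so the blocks are listed in the order A₁ < … < Aₘ < B₁ < … < Bₘ.

module _ {n : ℕ} (m : ℕ) (blk : Fin n → Fin (m + m)) where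

  inA : Fin m → Fin n → Bool
  inA i v = blk v == (i ↑ˡ m)

  inB : Fin m → Fin n → Bool
  inB i v = blk v == (m ↑ʳ i)

  inAB : Fin m → Fin n → Bool
  inAB i v = inA i v ∨ inB i v

module Submission where

-- The pairs (A₀, B₀), (A₁, B₁), … are contracted one after the other. While the pair (A_ℓ, B_ℓ)
-- is processed, all earlier A-blocks form one part and all earlier B-blocks another, A_ℓ and B_ℓ
-- are cut into the pieces of the parts of a partition from the given contraction sequence of
-- A_ℓ ∪ B_ℓ, and all later blocks are singletons; each local merge is replayed as the merge
-- restricted to A_ℓ followed by the merge restricted to B_ℓ. The blocks are intervals of the
-- order and edges only join A_i to B_i, so two parts can only be non-homogeneous if they meet
-- the same block or two partner blocks. Hence a piece of A_ℓ is non-homogeneous to at most k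
-- pieces of A_ℓ and at most k + 2 pieces of B_ℓ (those with an adjacent local label, the one with
-- its own label, and one more between the two halves of a replayed merge), a piece of B_ℓ to at
-- most 2k + 1 pieces, the two big parts to at most two parts each, and singletons to nothing.
-- At the end of a phase, A_ℓ and B_ℓ join the big parts, and finally the two big parts merge.

open import Defs
open import Data.Nat.Base using (ℕ; _≤_; _+_; _*_)
open import Data.Bool.Base using (Bool; true; false)
open import Data.Fin.Base using (Fin; toℕ; _↑ˡ_; _↑ʳ_)
open import Data.Product.Base using (Σ; _×_)
open import Data.Sum.Base using (_⊎_)
open import Relation.Binary.PropositionalEquality.Core using (_≡_)

open import Data.Nat.Base using (zero; suc; _<_; _≡ᵇ_; _<ᵇ_; z≤n; s≤s)
open import Data.Nat.Properties hiding (_≟_)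
open import Data.Nat.Properties using () renaming (_≟_ to _≟ℕ_)
open import Data.Bool.Base using (_∧_; _∨_; not; if_then_else_)
open import Data.Bool.Properties using (T-≡; ¬-not; ∨-zeroʳ; ∨-comm; ∨-identityʳ; ∧-inverseʳ)
open import Data.Fin.Base using (fromℕ<)
open import Data.Fin.Properties using (_≟_; toℕ-injective; toℕ<n; toℕ-↑ˡ; toℕ-↑ʳ; toℕ-fromℕ<)
open import Data.List.Base using (List; []; _∷_; length; filterᵇ; map; _++_)
open import Data.List.Properties using (length-++; length-map)
open import Data.List.Membership.Propositional using (_∈_)
open import Data.List.Membership.Propositional.Properties using (∈-filter⁺; ∈-filter⁻; ∈-allFin; ∈-map⁺; ∈-++⁺ˡ; ∈-++⁺ʳ)
open import Data.List.Relation.Unary.Any as Any using (here; there; satisfied)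
open import Data.List.Relation.Unary.Any.Properties using (any⁺; any⁻)
open import Data.List.Relation.Unary.All using (All; _∷_)
open import Data.List.Relation.Unary.AllPairs using (_∷_)
open import Data.List.Relation.Unary.Unique.Propositional using (Unique)
open import Data.List.Relation.Unary.Unique.Propositional.Properties using (filter⁺; allFin⁺)
open import Data.Product.Base using (∃; ∃₂; _,_; proj₁; proj₂)
open import Data.Sum.Base using (inj₁; inj₂; [_,_]; map₁; map₂; swap)
open import Data.Empty using (⊥-elim)
open import Function.Base using (_∘_)
open import Function.Bundles using (Equivalence)
open import Relation.Nullary using (¬_; yes; no)
open import Relation.Nullary.Decidable using (dec-true; dec-false; isYes≗does)
open import Relation.Nullary.Decidable.Core using (T?)
open import Relation.Binary.Definitions using (tri<; tri≈; tri>)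
open import Relation.Binary.PropositionalEquality using (_≢_; refl; sym; trans; cong; cong₂; subst; subst₂)

open Equivalence using (to; from)

∧-true⁻ : ∀ {a b} → (a ∧ b) ≡ true → a ≡ true × b ≡ true
∧-true⁻ {true} {true} _ = refl , refl

∧-true⁺ : ∀ {a b} → a ≡ true → b ≡ true → (a ∧ b) ≡ true
∧-true⁺ refl refl = refl

<ᵇ-true : ∀ {a b} → a < b → (a <ᵇ b) ≡ true
<ᵇ-true a<b = to T-≡ (<⇒<ᵇ a<b)

<ᵇ-false : ∀ {a b} → b ≤ a → (a <ᵇ b) ≡ false
<ᵇ-false {a} {b} b≤a = ¬-not λ a<ᵇb → <⇒≱ (<ᵇ⇒< a b (from T-≡ a<ᵇb)) b≤a

≡ᵇ-true : ∀ {a b} → a ≡ b → (a ≡ᵇ b) ≡ true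
≡ᵇ-true {a} {b} a≡b = to T-≡ (≡⇒≡ᵇ a b a≡b)

≡ᵇ-false : ∀ {a b} → a ≢ b → (a ≡ᵇ b) ≡ false
≡ᵇ-false {a} {b} a≢b = ¬-not λ a≡ᵇb → a≢b (≡ᵇ⇒≡ a b (from T-≡ a≡ᵇb))

≡ᵇ-true⇒≡ : ∀ {a b} → (a ≡ᵇ b) ≡ true → a ≡ b
≡ᵇ-true⇒≡ {a} {b} e = ≡ᵇ⇒≡ a b (from T-≡ e)

module _ {n : ℕ} where

  ==⇒≡ : {a b : Fin n} → (a == b) ≡ true → a ≡ b
  ==⇒≡ {a} {b} e with a ≟ b
  ... | yes a≡b = a≡b
  ==⇒≡ () | no _

  ≡⇒== : {a b : Fin n} → a ≡ b → (a == b) ≡ true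
  ≡⇒== {a} {b} a≡b = trans (isYes≗does (a ≟ b)) (dec-true (a ≟ b) a≡b)

  ≢⇒==false : {a b : Fin n} → a ≢ b → (a == b) ≡ false
  ≢⇒==false {a} {b} a≢b = trans (isYes≗does (a ≟ b)) (dec-false (a ≟ b) a≢b)

  ==-cong : {x y x′ y′ : Fin n} → (x ≡ y → x′ ≡ y′) → (x′ ≡ y′ → x ≡ y) → (x == y) ≡ (x′ == y′)
  ==-cong {x} {y} {x′} {y′} forward backward with x ≟ y | x′ ≟ y′
  ... | yes _ | yes _ = refl
  ... | yes x≡y | no x′≢y′ = ⊥-elim (x′≢y′ (forward x≡y))
  ... | no x≢y | yes x′≡y′ = ⊥-elim (x≢y (backward x′≡y′))
  ... | no _ | no _ = refl

  anyV⁺ : (p : Fin n → Bool) (x : Fin n) → p x ≡ true → anyV p ≡ true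
  anyV⁺ p x px = to T-≡ (any⁺ p (Any.map (λ { refl → from T-≡ px }) (∈-allFin x)))

  anyV⁻ : (p : Fin n → Bool) → anyV p ≡ true → ∃ λ x → p x ≡ true
  anyV⁻ p e with x , px ← satisfied (any⁻ p verts (from T-≡ e)) = x , to T-≡ px

  anyV-false⁻ : (p : Fin n → Bool) → anyV p ≡ false → ∀ x → p x ≡ false
  anyV-false⁻ p e x = ¬-not λ px → subst (_≢ true) (sym e) (λ ()) (anyV⁺ p x px)

  private
    remove : (ys : List (Fin n)) {x : Fin n} → x ∈ ys → List (Fin n)
    remove (_ ∷ ys) (here _) = ys
    remove (y ∷ ys) (there x∈ys) = y ∷ remove ys x∈ys

    length-remove : (ys : List (Fin n)) {x : Fin n} (x∈ys : x ∈ ys) → suc (length (remove ys x∈ys)) ≡ length ys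
    length-remove (_ ∷ ys) (here _) = refl
    length-remove (_ ∷ ys) (there x∈ys) = cong suc (length-remove ys x∈ys)

    ∈-remove : (ys : List (Fin n)) {x y : Fin n} (x∈ys : x ∈ ys) → y ∈ ys → y ≢ x → y ∈ remove ys x∈ys
    ∈-remove (_ ∷ ys) (here refl) (here refl) y≢x = ⊥-elim (y≢x refl)
    ∈-remove (_ ∷ ys) (here _) (there y∈ys) _ = y∈ys
    ∈-remove (_ ∷ ys) (there _) (here refl) _ = here refl
    ∈-remove (_ ∷ ys) (there x∈ys) (there y∈ys) y≢x = there (∈-remove ys x∈ys y∈ys y≢x)

    All≢⇒≢ : {x y : Fin n} {xs : List (Fin n)} → All (x ≢_) xs → y ∈ xs → y ≢ x
    All≢⇒≢ (x≢y ∷ _) (here refl) y≡x = x≢y (sym y≡x)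
    All≢⇒≢ (_ ∷ xs) (there y∈xs) = All≢⇒≢ xs y∈xs

  Unique⇒length-≤ : (xs ys : List (Fin n)) → Unique xs → (∀ {x} → x ∈ xs → x ∈ ys) → length xs ≤ length ys
  Unique⇒length-≤ [] ys _ _ = z≤n
  Unique⇒length-≤ (x ∷ xs) ys (x∉xs ∷ uxs) xs⊆ys =
    subst (suc (length xs) ≤_) (length-remove ys x∈ys)
      (s≤s (Unique⇒length-≤ xs (remove ys x∈ys) uxs
        (λ y∈xs → ∈-remove ys x∈ys (xs⊆ys (there y∈xs)) (All≢⇒≢ x∉xs y∈xs))))
    where x∈ys = xs⊆ys (here refl)

  length-filterᵇ-≤ : (p : Fin n → Bool) (ys : List (Fin n)) → (∀ x → p x ≡ true → x ∈ ys) →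
                     length (filterᵇ p verts) ≤ length ys
  length-filterᵇ-≤ p ys h = Unique⇒length-≤ (filterᵇ p verts) ys (filter⁺ (T? ∘ p) (allFin⁺ n))
    (λ x∈ → h _ (to T-≡ (proj₂ (∈-filter⁻ (T? ∘ p) {xs = verts} x∈))))

  ∈-filterᵇ⁺ : (p : Fin n → Bool) (x : Fin n) → p x ≡ true → x ∈ filterᵇ p verts
  ∈-filterᵇ⁺ p x px = ∈-filter⁺ (λ y → T? (p y)) (∈-allFin x) (from T-≡ px)

  firstIn : (Fin n → Bool) → List (Fin n) → Fin n → Fin n
  firstIn p [] d = d
  firstIn p (x ∷ xs) d = if p x then x else firstIn p xs d

  first : (Fin n → Bool) → Fin n → Fin n
  first p d = firstIn p verts d

  private
    firstIn-satisfies : (p : Fin n → Bool) (xs : List (Fin n)) (d x : Fin n) → x ∈ xs → p x ≡ true →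
                        p (firstIn p xs d) ≡ true
    firstIn-satisfies p (y ∷ xs) d x x∈ px with p y in py
    ... | true = py
    firstIn-satisfies p (y ∷ xs) d x (here refl) px | false = ⊥-elim (subst (_≢ true) (sym py) (λ ()) px)
    firstIn-satisfies p (y ∷ xs) d x (there x∈) px | false = firstIn-satisfies p xs d x x∈ px

    firstIn-cong : (p q : Fin n → Bool) (xs : List (Fin n)) (d : Fin n) → (∀ x → p x ≡ q x) →
                   firstIn p xs d ≡ firstIn q xs d
    firstIn-cong p q [] d p≗q = refl
    firstIn-cong p q (y ∷ xs) d p≗q rewrite p≗q y | firstIn-cong p q xs d p≗q = refl

    firstIn-∨ : (p q : Fin n → Bool) (xs : List (Fin n)) (d : Fin n) →
                firstIn (λ w → p w ∨ q w) xs d ≡ firstIn p xs d ⊎ firstIn (λ w → p w ∨ q w) xs d ≡ firstIn q xs d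
    firstIn-∨ p q [] d = inj₁ refl
    firstIn-∨ p q (y ∷ xs) d with p y | q y
    ... | true | _ = inj₁ refl
    ... | false | true = inj₂ refl
    ... | false | false = firstIn-∨ p q xs d

  first-satisfies : (p : Fin n → Bool) (d x : Fin n) → p x ≡ true → p (first p d) ≡ true
  first-satisfies p d x = firstIn-satisfies p verts d x (∈-allFin x)

  first-cong : (p q : Fin n → Bool) (d : Fin n) → (∀ x → p x ≡ q x) → first p d ≡ first q d
  first-cong p q d = firstIn-cong p q verts d

  first-∨ : (p q : Fin n → Bool) (d : Fin n) →
            first (λ w → p w ∨ q w) d ≡ first p d ⊎ first (λ w → p w ∨ q w) d ≡ first q d
  first-∨ p q d = firstIn-∨ p q verts d

module _ {n : ℕ} (E : Fin n → Fin n → Bool) where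

  Violates : Fin n → Fin n → Fin n → Fin n → Bool
  Violates x₁ x₂ y₁ y₂ = viol E x₁ y₁ x₂ y₂ ∨ viol E y₁ x₁ y₂ x₂ ∨
                         viol ltᵇ x₁ y₁ x₂ y₂ ∨ viol ltᵇ y₁ x₁ y₂ x₂

  record NonHomogeneous (X Y : Fin n → Bool) : Set where
    field
      x₁ x₂ y₁ y₂ : Fin n
      x₁∈X : X x₁ ≡ true
      x₂∈X : X x₂ ≡ true
      y₁∈Y : Y y₁ ≡ true
      y₂∈Y : Y y₂ ≡ true
      violates : Violates x₁ x₂ y₁ y₂ ≡ true

  open NonHomogeneous

  NonHomogeneous-mono : ∀ {X X′ Y Y′} → (∀ x → X x ≡ true → X′ x ≡ true) → (∀ y → Y y ≡ true → Y′ y ≡ true) →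
                        NonHomogeneous X Y → NonHomogeneous X′ Y′
  NonHomogeneous-mono X⊆X′ Y⊆Y′ w = record
    { x₁∈X = X⊆X′ _ (x₁∈X w) ; x₂∈X = X⊆X′ _ (x₂∈X w)
    ; y₁∈Y = Y⊆Y′ _ (y₁∈Y w) ; y₂∈Y = Y⊆Y′ _ (y₂∈Y w)
    ; violates = violates w }

  NonHomogeneous-sym : ∀ {X Y} → NonHomogeneous X Y → NonHomogeneous Y X
  NonHomogeneous-sym w = record
    { x₁∈X = y₁∈Y w ; x₂∈X = y₂∈Y w ; y₁∈Y = x₁∈X w ; y₂∈Y = x₂∈X w
    ; violates = swapped (viol E (x₁ w) (y₁ w) (x₂ w) (y₂ w)) (viol E (y₁ w) (x₁ w) (y₂ w) (x₂ w))
                      (viol ltᵇ (x₁ w) (y₁ w) (x₂ w) (y₂ w)) (viol ltᵇ (y₁ w) (x₁ w) (y₂ w) (x₂ w)) (violates w) }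
    where
      swapped : ∀ a b c d → (a ∨ b ∨ c ∨ d) ≡ true → (b ∨ a ∨ d ∨ c) ≡ true
      swapped true b c d _ = ∨-zeroʳ b
      swapped false true c d _ = refl
      swapped false false c d e = trans (∨-comm d c) e

  Violates-diagonal : ∀ x y → Violates x x y y ≡ false
  Violates-diagonal x y
    rewrite ∧-inverseʳ (E x y) | ∧-inverseʳ (E y x) | ∧-inverseʳ (ltᵇ x y) | ∧-inverseʳ (ltᵇ y x) = refl

  singletons-homogeneous : ∀ {X Y} x₀ y₀ → (∀ x → X x ≡ true → x ≡ x₀) → (∀ y → Y y ≡ true → y ≡ y₀) →
                           ¬ NonHomogeneous X Y
  singletons-homogeneous x₀ y₀ X≡x₀ Y≡y₀ w =
    true≢false (trans (sym (violates w)) (trans at-singletons (Violates-diagonal x₀ y₀)))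
    where
      at-singletons : Violates (x₁ w) (x₂ w) (y₁ w) (y₂ w) ≡ Violates x₀ x₀ y₀ y₀
      at-singletons rewrite X≡x₀ _ (x₁∈X w) | X≡x₀ _ (x₂∈X w) | Y≡y₀ _ (y₁∈Y w) | Y≡y₀ _ (y₂∈Y w) = refl
      true≢false : true ≢ false
      true≢false ()

  -- When X lies before Y, the order relation is homogeneous between them.
  ordered-NonHomogeneous⇒edge : ∀ {X Y} → (∀ x y → X x ≡ true → Y y ≡ true → toℕ x < toℕ y) →
                                NonHomogeneous X Y → ∃₂ λ x y → X x ≡ true × Y y ≡ true × (E x y ≡ true ⊎ E y x ≡ true)
  ordered-NonHomogeneous⇒edge X<Y w =
    x₁ w , y₁ w , x₁∈X w , y₁∈Y w ,
    order-homogeneous (E (x₁ w) (y₁ w)) (E (y₁ w) (x₁ w))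
      (<⇒ltᵇ (X<Y _ _ (x₁∈X w) (y₁∈Y w))) (<⇒ltᵇ (X<Y _ _ (x₂∈X w) (y₂∈Y w))) (>⇒ltᵇ (X<Y _ _ (x₁∈X w) (y₁∈Y w)))
      (violates w)
    where
      <⇒ltᵇ : ∀ {x y} → toℕ x < toℕ y → ltᵇ x y ≡ true
      <⇒ltᵇ x<y = to T-≡ (<⇒<ᵇ x<y)
      >⇒ltᵇ : ∀ {x y} → toℕ x < toℕ y → ltᵇ y x ≡ false
      >⇒ltᵇ {x} {y} x<y = ¬-not λ y<x → <-asym x<y (<ᵇ⇒< (toℕ y) (toℕ x) (from T-≡ y<x))
      order-homogeneous : ∀ e₁ e₃ {e₂ e₄ l₁ l₂ l₃ l₄} → l₁ ≡ true → l₂ ≡ true → l₃ ≡ false →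
                          (e₁ ∧ not e₂ ∨ e₃ ∧ not e₄ ∨ l₁ ∧ not l₂ ∨ l₃ ∧ not l₄) ≡ true → e₁ ≡ true ⊎ e₃ ≡ true
      order-homogeneous true _ _ _ _ _ = inj₁ refl
      order-homogeneous false true _ _ _ _ = inj₂ refl
      order-homogeneous false false refl refl refl ()

module TwinWidthFacts {n : ℕ} (S : Fin n → Bool) (E : Fin n → Fin n → Bool) where
  open TwinWidth S E public

  inPart⁺ : ∀ cls {a v} → S v ≡ true → cls v ≡ a → inPart cls a v ≡ true
  inPart⁺ cls s refl = ∧-true⁺ s (≡⇒== refl)

  inPart⁻ : ∀ cls a v → inPart cls a v ≡ true → S v ≡ true × cls v ≡ a
  inPart⁻ cls a v e with s , eq ← ∧-true⁻ {S v} e = s , ==⇒≡ eq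

  occurs⁺ : ∀ cls {a} v → S v ≡ true → cls v ≡ a → occurs cls a ≡ true
  occurs⁺ cls {a} v s e = anyV⁺ (inPart cls a) v (inPart⁺ cls s e)

  occurs⁻ : ∀ cls a → occurs cls a ≡ true → ∃ λ v → S v ≡ true × cls v ≡ a
  occurs⁻ cls a e with v , p ← anyV⁻ (inPart cls a) e = v , inPart⁻ cls a v p

  NonHom : Labelling → Fin n → Fin n → Set
  NonHom cls a b = NonHomogeneous E (inPart cls a) (inPart cls b)

  private
    witnessed : Labelling → Fin n → Fin n → Fin n → Fin n → Fin n → Fin n → Bool
    witnessed cls a b x₁ x₂ y₁ y₂ =
      inPart cls a x₁ ∧ inPart cls a x₂ ∧ inPart cls b y₁ ∧ inPart cls b y₂ ∧ Violates E x₁ x₂ y₁ y₂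

  nonHom⁻ : ∀ cls a b → nonHom cls a b ≡ true → NonHom cls a b
  nonHom⁻ cls a b e
    with x₁ , e₁ ← anyV⁻ (λ x₁ → anyV λ x₂ → anyV λ y₁ → anyV λ y₂ → witnessed cls a b x₁ x₂ y₁ y₂) e
    with x₂ , e₂ ← anyV⁻ (λ x₂ → anyV λ y₁ → anyV λ y₂ → witnessed cls a b x₁ x₂ y₁ y₂) e₁
    with y₁ , e₃ ← anyV⁻ (λ y₁ → anyV λ y₂ → witnessed cls a b x₁ x₂ y₁ y₂) e₂
    with y₂ , e₄ ← anyV⁻ (λ y₂ → witnessed cls a b x₁ x₂ y₁ y₂) e₃
    with x₁∈ , e₅ ← ∧-true⁻ {inPart cls a x₁} e₄
    with x₂∈ , e₆ ← ∧-true⁻ {inPart cls a x₂} e₅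
    with y₁∈ , e₇ ← ∧-true⁻ {inPart cls b y₁} e₆
    with y₂∈ , v ← ∧-true⁻ {inPart cls b y₂} e₇
    = record { x₁∈X = x₁∈ ; x₂∈X = x₂∈ ; y₁∈Y = y₁∈ ; y₂∈Y = y₂∈ ; violates = v }

  nonHom⁺ : ∀ cls a b → NonHom cls a b → nonHom cls a b ≡ true
  nonHom⁺ cls a b w =
    anyV⁺ (λ x₁ → anyV λ x₂ → anyV λ y₁ → anyV λ y₂ → witnessed cls a b x₁ x₂ y₁ y₂) (x₁ w)
      (anyV⁺ (λ x₂ → anyV λ y₁ → anyV λ y₂ → witnessed cls a b (x₁ w) x₂ y₁ y₂) (x₂ w)
        (anyV⁺ (λ y₁ → anyV λ y₂ → witnessed cls a b (x₁ w) (x₂ w) y₁ y₂) (y₁ w)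
          (anyV⁺ (λ y₂ → witnessed cls a b (x₁ w) (x₂ w) (y₁ w) y₂) (y₂ w)
            (∧-true⁺ (x₁∈X w) (∧-true⁺ (x₂∈X w) (∧-true⁺ (y₁∈Y w) (∧-true⁺ (y₂∈Y w) (violates w))))))))
    where open NonHomogeneous

  adjacent : Labelling → Fin n → Fin n → Bool
  adjacent cls a b = occurs cls b ∧ not (a == b) ∧ nonHom cls a b

  neighbours : Labelling → Fin n → List (Fin n)
  neighbours cls a = filterᵇ (adjacent cls a) verts

  ∈-neighbours : ∀ cls a b → occurs cls b ≡ true → a ≢ b → NonHom cls a b → b ∈ neighbours cls a
  ∈-neighbours cls a b ob a≢b w =
    ∈-filterᵇ⁺ (adjacent cls a) b (∧-true⁺ ob (∧-true⁺ (cong not (≢⇒==false a≢b)) (nonHom⁺ cls a b w)))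

  errDeg-≤ : ∀ cls a (ys : List (Fin n)) → (∀ b → occurs cls b ≡ true → a ≢ b → NonHom cls a b → b ∈ ys) →
             errDeg cls a ≤ length ys
  errDeg-≤ cls a ys h = length-filterᵇ-≤ (adjacent cls a) ys λ b adj →
    let ob , r = ∧-true⁻ {occurs cls b} adj ; ne , nh = ∧-true⁻ {not (a == b)} r
    in h b ob (λ { refl → subst (λ x → not x ≢ true) (sym (≡⇒== {a = a} refl)) (λ ()) ne }) (nonHom⁻ cls a b nh)

  _≐_ : Labelling → Labelling → Set
  f ≐ g = ∀ v → S v ≡ true → f v ≡ g v

  occurs-resp : ∀ {f g a} → f ≐ g → occurs f a ≡ true → occurs g a ≡ true
  occurs-resp {f} {g} {a} f≐g o with v , s , e ← occurs⁻ f a o = occurs⁺ g v s (trans (sym (f≐g v s)) e)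

  NonHom-resp : ∀ {f g a b} → f ≐ g → NonHom f a b → NonHom g a b
  NonHom-resp {f} {g} f≐g = NonHomogeneous-mono E transport transport
    where
      transport : ∀ {c} x → inPart f c x ≡ true → inPart g c x ≡ true
      transport {c} x p with s , e ← inPart⁻ f c x p = inPart⁺ g s (trans (sym (f≐g x s)) e)

  ErrDegAtMost-resp : ∀ {d f g} → f ≐ g → ErrDegAtMost d f → ErrDegAtMost d g
  ErrDegAtMost-resp {f = f} {g} f≐g deg a oa =
    ≤-trans (errDeg-≤ g a (neighbours f a) λ b ob a≢b w →
               ∈-neighbours f a b (occurs-resp g≐f ob) a≢b (NonHom-resp g≐f w))
            (deg a (occurs-resp g≐f oa))
    where
      g≐f : g ≐ f
      g≐f v s = sym (f≐g v s)

  SeqFrom-resp : ∀ {d f g} → f ≐ g → SeqFrom d f → SeqFrom d g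
  SeqFrom-resp {g = g} f≐g (done f deg whole) =
    done g (ErrDegAtMost-resp f≐g deg) λ u v su sv → trans (sym (f≐g u su)) (trans (whole u v su sv) (f≐g v sv))
  SeqFrom-resp {g = g} f≐g (step f f′ deg (a , b , a≢b , oa , ob , merge) rest) =
    step g f′ (ErrDegAtMost-resp f≐g deg)
      (a , b , a≢b , occurs-resp f≐g oa , occurs-resp f≐g ob ,
       λ v s → subst (λ x → f′ v ≡ (if x == b then a else x)) (f≐g v s) (merge v s))
      rest

  SeqFrom⇒ErrDegAtMost : ∀ {d cls} → SeqFrom d cls → ErrDegAtMost d cls
  SeqFrom⇒ErrDegAtMost (done _ deg _) = deg
  SeqFrom⇒ErrDegAtMost (step _ _ deg _ _) = deg

  -- Merging a part into itself changes nothing, so it need not be a step of the sequence.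
  merge-or-stay : ∀ {d g g′} a b → ErrDegAtMost d g → occurs g a ≡ true → occurs g b ≡ true →
                  (∀ v → S v ≡ true → g′ v ≡ (if g v == b then a else g v)) → SeqFrom d g′ → SeqFrom d g
  merge-or-stay {g = g} a b deg oa ob merged rest with a ≟ b
  ... | no a≢b = step g _ deg (a , b , a≢b , oa , ob , merged) rest
  ... | yes refl = SeqFrom-resp (λ v s → trans (merged v s) (unchanged (g v))) rest
    where
      unchanged : ∀ x → (if x == a then a else x) ≡ x
      unchanged x with x ≟ a
      ... | yes x≡a = sym x≡a
      ... | no _ = refl

module Construction
  (n m k : ℕ) (E : Fin n → Fin n → Bool) (blk : Fin n → Fin (m + m))
  (E-sym : ∀ u v → E u v ≡ E v u)
  (blk-mono : ∀ u v → toℕ u ≤ toℕ v → toℕ (blk u) ≤ toℕ (blk v))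
  (blk-surj : ∀ j → Σ (Fin n) λ v → blk v ≡ j)
  (edges : ∀ u v → E u v ≡ true →
     Σ (Fin m) λ i → (inA m blk i u ≡ true × inB m blk i v ≡ true)
                   ⊎ (inB m blk i u ≡ true × inA m blk i v ≡ true))
  (0<m : 0 < m)
  where

  module G = TwinWidthFacts (λ _ → true) E
  module L (i : Fin m) = TwinWidthFacts (inAB m blk i) E

  -- A_i is block i and B_i is block m + i.
  block : Fin n → ℕ
  block v = toℕ (blk v)

  block<2m : ∀ v → block v < m + m
  block<2m v = toℕ<n (blk v)

  block<⇒< : ∀ u v → block u < block v → toℕ u < toℕ v
  block<⇒< u v bu<bv = ≰⇒> λ v≤u → <⇒≱ bu<bv (blk-mono v u v≤u)

  inA⇒block : ∀ i v → inA m blk i v ≡ true → block v ≡ toℕ i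
  inA⇒block i v e = trans (cong toℕ (==⇒≡ e)) (toℕ-↑ˡ i m)

  inB⇒block : ∀ i v → inB m blk i v ≡ true → block v ≡ m + toℕ i
  inB⇒block i v e = trans (cong toℕ (==⇒≡ e)) (toℕ-↑ʳ m i)

  block⇒inAB : ∀ i v → block v ≡ toℕ i ⊎ block v ≡ m + toℕ i → inAB m blk i v ≡ true
  block⇒inAB i v (inj₁ e) rewrite ≡⇒== (toℕ-injective (trans e (sym (toℕ-↑ˡ i m)))) = refl
  block⇒inAB i v (inj₂ e) rewrite ≡⇒== (toℕ-injective (trans e (sym (toℕ-↑ʳ m i)))) with inA m blk i v
  ... | true = refl
  ... | false = refl

  module _ (i : Fin m) {ℓ : ℕ} (i≡ℓ : toℕ i ≡ ℓ) where

    inAB-atA : ∀ v → block v ≡ ℓ → inAB m blk i v ≡ true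
    inAB-atA v bv≡ℓ = block⇒inAB i v (inj₁ (trans bv≡ℓ (sym i≡ℓ)))

    inAB-atB : ∀ v → block v ≡ m + ℓ → inAB m blk i v ≡ true
    inAB-atB v bv≡m+ℓ = block⇒inAB i v (inj₂ (trans bv≡m+ℓ (cong (m +_) (sym i≡ℓ))))

  edge⇒partner-blocks : ∀ u v → E u v ≡ true →
                        (block u < m × block v ≡ m + block u) ⊎ (block v < m × block u ≡ m + block v)
  edge⇒partner-blocks u v e with edges u v e
  ... | i , inj₁ (u∈A , v∈B) rewrite inA⇒block i u u∈A = inj₁ (toℕ<n i , inB⇒block i v v∈B)
  ... | i , inj₂ (u∈B , v∈A) rewrite inA⇒block i v v∈A = inj₂ (toℕ<n i , inB⇒block i u u∈B)

  no-partner-above : ∀ y x → m ≤ block x → block y ≢ m + block x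
  no-partner-above y x m≤bx by≡m+bx = <⇒≱ (block<2m y) (subst (m + m ≤_) (sym by≡m+bx) (+-monoʳ-≤ m m≤bx))

  part : ∀ cls {a x} → G.inPart cls a x ≡ true → cls x ≡ a
  part cls {a} {x} x∈a = proj₂ (G.inPart⁻ cls a x x∈a)

  some-member : ∀ cls {a b} → G.NonHom cls a b → ∃ λ y → cls y ≡ b
  some-member cls w = NonHomogeneous.y₁ w , part cls (NonHomogeneous.y₁∈Y w)

  BlockMonotone : (Fin n → Fin n) → Set
  BlockMonotone cls = ∀ u v → block (cls u) < block (cls v) → block u < block v

  private
    below⇒edge : ∀ cls → BlockMonotone cls → ∀ a b → block a < block b → G.NonHom cls a b →
                 ∃₂ λ x y → cls x ≡ a × cls y ≡ b × E x y ≡ true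
    below⇒edge cls mono a b ba<bb w = oriented (ordered-NonHomogeneous⇒edge E a-before-b w)
      where
        oriented : (∃₂ λ x y → G.inPart cls a x ≡ true × G.inPart cls b y ≡ true × (E x y ≡ true ⊎ E y x ≡ true)) →
                   ∃₂ λ x y → cls x ≡ a × cls y ≡ b × E x y ≡ true
        oriented (x , y , x∈a , y∈b , e) = x , y , part cls x∈a , part cls y∈b , [ (λ exy → exy) , (λ eyx → trans (E-sym x y) eyx) ] e
        a-before-b : ∀ x y → G.inPart cls a x ≡ true → G.inPart cls b y ≡ true → toℕ x < toℕ y
        a-before-b x y x∈a y∈b =
          block<⇒< x y (mono x y (subst₂ (λ p q → block p < block q) (sym (part cls x∈a)) (sym (part cls y∈b)) ba<bb))

  -- When cls never reverses the block order, parts with labels in different blocks are ordered,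
  -- so they can only be non-homogeneous through an edge.
  NonHom⇒same-block⊎edge : ∀ cls → BlockMonotone cls → ∀ a b → G.NonHom cls a b →
                           block a ≡ block b ⊎ ∃₂ λ x y → cls x ≡ a × cls y ≡ b × E x y ≡ true
  NonHom⇒same-block⊎edge cls mono a b w with <-cmp (block a) (block b)
  ... | tri≈ _ ba≡bb _ = inj₁ ba≡bb
  ... | tri< ba<bb _ _ = inj₂ (below⇒edge cls mono a b ba<bb w)
  ... | tri> _ _ bb<ba with y , x , y∈b , x∈a , e ← below⇒edge cls mono b a bb<ba (NonHomogeneous-sym E w)
    = inj₂ (x , y , x∈a , y∈b , trans (E-sym x y) e)

  someVertex : Fin n
  someVertex = proj₁ (blk-surj (fromℕ< (≤-trans 0<m (m≤m+n m m))))

  blockRep : ℕ → Fin n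
  blockRep j = first (λ w → block w ≡ᵇ j) someVertex

  block-blockRep : ∀ {j} → j < m + m → block (blockRep j) ≡ j
  block-blockRep {j} j<2m with v , e ← blk-surj (fromℕ< j<2m) =
    ≡ᵇ-true⇒≡ (first-satisfies (λ w → block w ≡ᵇ j) someVertex v (≡ᵇ-true (trans (cong toℕ e) (toℕ-fromℕ< j<2m))))

  hubA hubB : Fin n
  hubA = blockRep 0
  hubB = blockRep m

  block-hubA : block hubA ≡ 0
  block-hubA = block-blockRep (≤-trans 0<m (m≤m+n m m))

  block-hubB : block hubB ≡ m
  block-hubB = block-blockRep (subst (_< m + m) (+-identityʳ m) (+-monoʳ-< m 0<m))

  -- The global label of the local part t inside block j is its least vertex.
  pieceRep : (Fin n → Fin n) → ℕ → Fin n → Fin n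
  pieceRep c j t = first (λ w → (block w ≡ᵇ j) ∧ (c w == t)) someVertex

  pieceRep-spec : ∀ c {j t} v → block v ≡ j → c v ≡ t → block (pieceRep c j t) ≡ j × c (pieceRep c j t) ≡ t
  pieceRep-spec c {j} {t} v bv≡j cv≡t
    with b , e ← ∧-true⁻ {block (pieceRep c j t) ≡ᵇ j}
                   (first-satisfies (λ w → (block w ≡ᵇ j) ∧ (c w == t)) someVertex v (∧-true⁺ (≡ᵇ-true bv≡j) (≡⇒== cv≡t)))
    = ≡ᵇ-true⇒≡ b , ==⇒≡ e

  pieceRep-cong : ∀ c c′ j t t′ → (∀ w → block w ≡ j → (c w ≡ t → c′ w ≡ t′) × (c′ w ≡ t′ → c w ≡ t)) →
                  pieceRep c j t ≡ pieceRep c′ j t′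
  pieceRep-cong c c′ j t t′ same = first-cong _ _ someVertex same-test
    where
      same-test : ∀ w → ((block w ≡ᵇ j) ∧ (c w == t)) ≡ ((block w ≡ᵇ j) ∧ (c′ w == t′))
      same-test w with block w ≡ᵇ j in bw≡ᵇj
      ... | false = refl
      ... | true = let forward , backward = same w (≡ᵇ-true⇒≡ bw≡ᵇj) in ==-cong forward backward

  data Zone (p₁ p₃ b : ℕ) : Set where
    mergedA : b < p₁ → Zone p₁ p₃ b
    freeA : p₁ ≤ b → b < m → Zone p₁ p₃ b
    mergedB : m ≤ b → b < p₃ → Zone p₁ p₃ b
    freeB : p₃ ≤ b → Zone p₁ p₃ b

  zone : ∀ p₁ p₃ b → Zone p₁ p₃ b
  zone p₁ p₃ b with b <? p₁ | b <? m | b <? p₃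
  ... | yes b<p₁ | _ | _ = mergedA b<p₁
  ... | no b≮p₁ | yes b<m | _ = freeA (≮⇒≥ b≮p₁) b<m
  ... | no _ | no b≮m | yes b<p₃ = mergedB (≮⇒≥ b≮m) b<p₃
  ... | no _ | no _ | no b≮p₃ = freeB (≮⇒≥ b≮p₃)

  Free : ℕ → ℕ → ℕ → Set
  Free p₁ p₃ b = p₁ ≤ b × (b < m ⊎ p₃ ≤ b)

  module Shaped (p₁ p₃ : ℕ) (p₁≤m : p₁ ≤ m) (m≤p₃ : m ≤ p₃) (cls : Fin n → Fin n)
    (cls-mergedA : ∀ x → block x < p₁ → cls x ≡ hubA)
    (cls-mergedB : ∀ x → m ≤ block x → block x < p₃ → cls x ≡ hubB)
    (cls-free : ∀ x → Free p₁ p₃ (block x) → block (cls x) ≡ block x) where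

    private
      p₁≤p₃ : p₁ ≤ p₃
      p₁≤p₃ = ≤-trans p₁≤m m≤p₃

      blockA : ∀ x → block x < p₁ → block (cls x) ≡ 0
      blockA x bx<p₁ = trans (cong block (cls-mergedA x bx<p₁)) block-hubA

      blockB : ∀ x → m ≤ block x → block x < p₃ → block (cls x) ≡ m
      blockB x m≤bx bx<p₃ = trans (cong block (cls-mergedB x m≤bx bx<p₃)) block-hubB

      freeB-block : ∀ x → p₃ ≤ block x → block (cls x) ≡ block x
      freeB-block x p₃≤bx = cls-free x (≤-trans p₁≤p₃ p₃≤bx , inj₂ p₃≤bx)

    block-monotone : BlockMonotone cls
    block-monotone u v lt with zone p₁ p₃ (block u) | zone p₁ p₃ (block v)
    ... | mergedA u< | mergedA v< = ⊥-elim (<-irrefl (trans (blockA u u<) (sym (blockA v v<))) lt)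
    ... | mergedA u< | freeA v≥ _ = <-≤-trans u< v≥
    ... | mergedA u< | mergedB v≥ _ = <-≤-trans u< (≤-trans p₁≤m v≥)
    ... | mergedA u< | freeB v≥ = <-≤-trans u< (≤-trans p₁≤p₃ v≥)
    ... | freeA _ _ | mergedA v< = ⊥-elim (n≮0 (subst (_ <_) (blockA v v<) lt))
    ... | freeA u≥ u< | freeA v≥ v< = subst₂ _<_ (cls-free u (u≥ , inj₁ u<)) (cls-free v (v≥ , inj₁ v<)) lt
    ... | freeA _ u< | mergedB v≥ _ = <-≤-trans u< v≥
    ... | freeA _ u< | freeB v≥ = <-≤-trans u< (≤-trans m≤p₃ v≥)
    ... | mergedB _ _ | mergedA v< = ⊥-elim (n≮0 (subst (_ <_) (blockA v v<) lt))
    ... | mergedB u≥ u< | freeA v≥ v< =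
      ⊥-elim (<-asym (subst₂ _<_ (blockB u u≥ u<) (cls-free v (v≥ , inj₁ v<)) lt) v<)
    ... | mergedB u≥ u< | mergedB v≥ v< = ⊥-elim (<-irrefl (trans (blockB u u≥ u<) (sym (blockB v v≥ v<))) lt)
    ... | mergedB _ u< | freeB v≥ = <-≤-trans u< v≥
    ... | freeB _ | mergedA v< = ⊥-elim (n≮0 (subst (_ <_) (blockA v v<) lt))
    ... | freeB u≥ | freeA v≥ v< =
      ⊥-elim (<⇒≱ (<-trans (subst₂ _<_ (freeB-block u u≥) (cls-free v (v≥ , inj₁ v<)) lt) v<) (≤-trans m≤p₃ u≥))
    ... | freeB u≥ | mergedB v≥ v< =
      ⊥-elim (<⇒≱ (subst₂ _<_ (freeB-block u u≥) (blockB v v≥ v<) lt) (≤-trans m≤p₃ u≥))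
    ... | freeB u≥ | freeB v≥ = subst₂ _<_ (freeB-block u u≥) (freeB-block v v≥) lt

    mergedA⁻ : ∀ x → block (cls x) < p₁ → block x < p₁
    mergedA⁻ x bcx<p₁ with zone p₁ p₃ (block x)
    ... | mergedA bx<p₁ = bx<p₁
    ... | freeA p₁≤bx bx<m = ⊥-elim (<⇒≱ bcx<p₁ (subst (p₁ ≤_) (sym (cls-free x (p₁≤bx , inj₁ bx<m))) p₁≤bx))
    ... | mergedB m≤bx bx<p₃ = ⊥-elim (<⇒≱ bcx<p₁ (subst (p₁ ≤_) (sym (blockB x m≤bx bx<p₃)) p₁≤m))
    ... | freeB p₃≤bx = ⊥-elim (<⇒≱ bcx<p₁ (subst (p₁ ≤_) (sym (freeB-block x p₃≤bx)) (≤-trans p₁≤p₃ p₃≤bx)))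

    mergedB⁻ : ∀ x → m ≤ block (cls x) → block (cls x) < p₃ → m ≤ block x × block x < p₃
    mergedB⁻ x m≤bcx bcx<p₃ with zone p₁ p₃ (block x)
    ... | mergedA bx<p₁ = ⊥-elim (<⇒≱ 0<m (subst (m ≤_) (blockA x bx<p₁) m≤bcx))
    ... | freeA p₁≤bx bx<m = ⊥-elim (<⇒≱ bx<m (subst (m ≤_) (cls-free x (p₁≤bx , inj₁ bx<m)) m≤bcx))
    ... | mergedB m≤bx bx<p₃ = m≤bx , bx<p₃
    ... | freeB p₃≤bx = ⊥-elim (<⇒≱ bcx<p₃ (subst (p₃ ≤_) (sym (freeB-block x p₃≤bx)) p₃≤bx))

    free⁻ : ∀ x → Free p₁ p₃ (block (cls x)) → block (cls x) ≡ block x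
    free⁻ x (p₁≤bcx , bcx<m⊎p₃≤bcx) with zone p₁ p₃ (block x)
    ... | mergedA bx<p₁ = ⊥-elim (n≮0 (<-≤-trans bx<p₁ (subst (p₁ ≤_) (blockA x bx<p₁) p₁≤bcx)))
    ... | freeA p₁≤bx bx<m = cls-free x (p₁≤bx , inj₁ bx<m)
    ... | mergedB m≤bx bx<p₃ with bcx<m⊎p₃≤bcx
    ...   | inj₁ bcx<m = ⊥-elim (<-irrefl (blockB x m≤bx bx<p₃) bcx<m)
    ...   | inj₂ p₃≤bcx = ⊥-elim (<⇒≱ bx<p₃ (≤-trans (subst (p₃ ≤_) (blockB x m≤bx bx<p₃) p₃≤bcx) m≤bx))
    free⁻ x _ | freeB p₃≤bx = freeB-block x p₃≤bx

    in-mergedA : ∀ x₀ x → block x₀ < p₁ → block (cls x) ≡ block (cls x₀) → block x < p₁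
    in-mergedA x₀ x bx₀<p₁ eq = mergedA⁻ x (subst (_< p₁) (sym (trans eq (blockA x₀ bx₀<p₁))) (≤-<-trans z≤n bx₀<p₁))

    in-mergedB : ∀ x₀ x → m ≤ block x₀ → block x₀ < p₃ → block (cls x) ≡ block (cls x₀) → m ≤ block x × block x < p₃
    in-mergedB x₀ x m≤bx₀ bx₀<p₃ eq =
      mergedB⁻ x (subst (m ≤_) (sym bcx≡m) ≤-refl) (subst (_< p₃) (sym bcx≡m) (≤-<-trans m≤bx₀ bx₀<p₃))
      where bcx≡m = trans eq (blockB x₀ m≤bx₀ bx₀<p₃)

    in-free : ∀ x₀ x → Free p₁ p₃ (block x₀) → block (cls x) ≡ block (cls x₀) → block x ≡ block x₀
    in-free x₀ x free eq = trans (sym (free⁻ x (subst (Free p₁ p₃) (sym bcx≡bx₀) free))) bcx≡bx₀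
      where bcx≡bx₀ = trans eq (cls-free x₀ free)

    hubA-neighbour : ∀ x₀ b → block x₀ < p₁ → cls x₀ ≢ b → G.NonHom cls (cls x₀) b →
                     ∃ λ y → cls y ≡ b × m ≤ block y × block y < m + p₁
    hubA-neighbour x₀ b bx₀<p₁ a≢b w with NonHom⇒same-block⊎edge cls block-monotone (cls x₀) b w
    ... | inj₁ same with y , refl ← some-member cls w =
      ⊥-elim (a≢b (trans (cls-mergedA x₀ bx₀<p₁) (sym (cls-mergedA y (in-mergedA x₀ y bx₀<p₁ (sym same))))))
    ... | inj₂ (x , y , cx , cy , e) with edge⇒partner-blocks x y e | in-mergedA x₀ x bx₀<p₁ (cong block cx)
    ...   | inj₁ (_ , by≡m+bx) | bx<p₁ =
      y , cy , subst (m ≤_) (sym by≡m+bx) (m≤m+n m _) , subst (_< m + p₁) (sym by≡m+bx) (+-monoʳ-< m bx<p₁)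
    ...   | inj₂ (_ , bx≡m+by) | bx<p₁ = ⊥-elim (<⇒≱ (<-≤-trans bx<p₁ p₁≤m) (subst (m ≤_) (sym bx≡m+by) (m≤m+n m _)))

    hubB-neighbour : ∀ x₀ b → m ≤ block x₀ → block x₀ < p₃ → cls x₀ ≢ b → G.NonHom cls (cls x₀) b →
                     ∃ λ y → cls y ≡ b × block y < m × m + block y < p₃
    hubB-neighbour x₀ b m≤bx₀ bx₀<p₃ a≢b w with NonHom⇒same-block⊎edge cls block-monotone (cls x₀) b w
    ... | inj₁ same with y , refl ← some-member cls w with m≤by , by<p₃ ← in-mergedB x₀ y m≤bx₀ bx₀<p₃ (sym same) =
      ⊥-elim (a≢b (trans (cls-mergedB x₀ m≤bx₀ bx₀<p₃) (sym (cls-mergedB y m≤by by<p₃))))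
    ... | inj₂ (x , y , cx , cy , e) with edge⇒partner-blocks x y e | in-mergedB x₀ x m≤bx₀ bx₀<p₃ (cong block cx)
    ...   | inj₁ (bx<m , _) | m≤bx , _ = ⊥-elim (<⇒≱ bx<m m≤bx)
    ...   | inj₂ (by<m , bx≡m+by) | _ , bx<p₃ = y , cy , by<m , subst (_< p₃) bx≡m+by bx<p₃

    free-neighbour : ∀ x₀ b → Free p₁ p₃ (block x₀) → G.NonHom cls (cls x₀) b →
                     ∃ λ y → cls y ≡ b × (block y ≡ block x₀ ⊎ block y ≡ m + block x₀ ⊎ block x₀ ≡ m + block y)
    free-neighbour x₀ b free w with NonHom⇒same-block⊎edge cls block-monotone (cls x₀) b w
    ... | inj₁ same with y , refl ← some-member cls w = y , refl , inj₁ (in-free x₀ y free (sym same))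
    ... | inj₂ (x , y , cx , cy , e) with edge⇒partner-blocks x y e | in-free x₀ x free (cong block cx)
    ...   | inj₁ (_ , by≡m+bx) | bx≡bx₀ = y , cy , inj₂ (inj₁ (trans by≡m+bx (cong (m +_) bx≡bx₀)))
    ...   | inj₂ (_ , bx≡m+by) | bx≡bx₀ = y , cy , inj₂ (inj₂ (trans (sym bx≡bx₀) bx≡m+by))

    free-singleton : ∀ x₀ → Free p₁ p₃ (block x₀) → (∀ x → block x ≡ block x₀ → cls x ≡ x) →
                     ∀ x → cls x ≡ cls x₀ → x ≡ x₀
    free-singleton x₀ free fixed x cx≡cx₀ =
      trans (sym (fixed x bx≡bx₀)) (trans cx≡cx₀ (fixed x₀ refl))
      where bx≡bx₀ = in-free x₀ x free (cong block cx≡cx₀)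

  data Position (ℓ b : ℕ) : Set where
    belowA : b < ℓ → Position ℓ b
    atA : b ≡ ℓ → Position ℓ b
    aboveA : ℓ < b → b < m → Position ℓ b
    belowB : m ≤ b → b < m + ℓ → Position ℓ b
    atB : b ≡ m + ℓ → Position ℓ b
    aboveB : m + ℓ < b → Position ℓ b

  position : ∀ ℓ b → Position ℓ b
  position ℓ b with <-cmp b ℓ
  ... | tri< b<ℓ _ _ = belowA b<ℓ
  ... | tri≈ _ b≡ℓ _ = atA b≡ℓ
  ... | tri> _ _ ℓ<b with b <? m
  ...   | yes b<m = aboveA ℓ<b b<m
  ...   | no b≮m with <-cmp b (m + ℓ)
  ...     | tri< b<m+ℓ _ _ = belowB (≮⇒≥ b≮m) b<m+ℓ
  ...     | tri≈ _ b≡m+ℓ _ = atB b≡m+ℓ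
  ...     | tri> _ _ m+ℓ<b = aboveB m+ℓ<b

  -- The partition while the pair (A_ℓ, B_ℓ) is contracted along local labellings ca and cb.
  phaseState : ℕ → (Fin n → Fin n) → (Fin n → Fin n) → Fin n → Fin n
  phaseState ℓ ca cb v =
    if block v <ᵇ ℓ then hubA
    else if block v ≡ᵇ ℓ then pieceRep ca ℓ (ca v)
    else if block v <ᵇ m then v
    else if block v <ᵇ m + ℓ then hubB
    else if block v ≡ᵇ m + ℓ then pieceRep cb (m + ℓ) (cb v)
    else v

  module _ {ℓ : ℕ} (ℓ<m : ℓ < m) (ca cb : Fin n → Fin n) where

    private
      ≥m⇒≢ℓ : ∀ {b} → m ≤ b → b ≢ ℓ
      ≥m⇒≢ℓ m≤b b≡ℓ = <⇒≱ ℓ<m (subst (m ≤_) b≡ℓ m≤b)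

      ≥m-at : ∀ {b} → b ≡ m + ℓ → m ≤ b
      ≥m-at b≡m+ℓ = subst (m ≤_) (sym b≡m+ℓ) (m≤m+n m ℓ)

      ≥m-above : ∀ {b} → m + ℓ < b → m ≤ b
      ≥m-above m+ℓ<b = ≤-trans (m≤m+n m ℓ) (<⇒≤ m+ℓ<b)

    phaseState-belowA : ∀ v → block v < ℓ → phaseState ℓ ca cb v ≡ hubA
    phaseState-belowA v bv<ℓ rewrite <ᵇ-true bv<ℓ = refl

    phaseState-atA : ∀ v → block v ≡ ℓ → phaseState ℓ ca cb v ≡ pieceRep ca ℓ (ca v)
    phaseState-atA v bv≡ℓ rewrite <ᵇ-false (≤-reflexive (sym bv≡ℓ)) | ≡ᵇ-true bv≡ℓ = refl

    phaseState-aboveA : ∀ v → ℓ < block v → block v < m → phaseState ℓ ca cb v ≡ v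
    phaseState-aboveA v ℓ<bv bv<m rewrite <ᵇ-false (<⇒≤ ℓ<bv) | ≡ᵇ-false (>⇒≢ ℓ<bv) | <ᵇ-true bv<m = refl

    phaseState-belowB : ∀ v → m ≤ block v → block v < m + ℓ → phaseState ℓ ca cb v ≡ hubB
    phaseState-belowB v m≤bv bv<m+ℓ
      rewrite <ᵇ-false (≤-trans (<⇒≤ ℓ<m) m≤bv) | ≡ᵇ-false (≥m⇒≢ℓ m≤bv) | <ᵇ-false m≤bv | <ᵇ-true bv<m+ℓ = refl

    phaseState-atB : ∀ v → block v ≡ m + ℓ → phaseState ℓ ca cb v ≡ pieceRep cb (m + ℓ) (cb v)
    phaseState-atB v bv≡m+ℓ
      rewrite <ᵇ-false (≤-trans (<⇒≤ ℓ<m) (≥m-at bv≡m+ℓ)) | ≡ᵇ-false (≥m⇒≢ℓ (≥m-at bv≡m+ℓ)) | <ᵇ-false (≥m-at bv≡m+ℓ)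
            | <ᵇ-false (≤-reflexive (sym bv≡m+ℓ)) | ≡ᵇ-true bv≡m+ℓ = refl

    phaseState-aboveB : ∀ v → m + ℓ < block v → phaseState ℓ ca cb v ≡ v
    phaseState-aboveB v m+ℓ<bv
      rewrite <ᵇ-false (≤-trans (<⇒≤ ℓ<m) (≥m-above m+ℓ<bv)) | ≡ᵇ-false (≥m⇒≢ℓ (≥m-above m+ℓ<bv)) | <ᵇ-false (≥m-above m+ℓ<bv)
            | <ᵇ-false (<⇒≤ m+ℓ<bv) | ≡ᵇ-false (>⇒≢ m+ℓ<bv) = refl

    phaseState-free : ∀ v → Free ℓ (m + ℓ) (block v) → block (phaseState ℓ ca cb v) ≡ block v
    phaseState-free v (ℓ≤bv , inj₁ bv<m) with m≤n⇒m<n∨m≡n ℓ≤bv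
    ... | inj₁ ℓ<bv = cong block (phaseState-aboveA v ℓ<bv bv<m)
    ... | inj₂ ℓ≡bv = trans (cong block (phaseState-atA v (sym ℓ≡bv))) (trans (proj₁ (pieceRep-spec ca v (sym ℓ≡bv) refl)) ℓ≡bv)
    phaseState-free v (_ , inj₂ m+ℓ≤bv) with m≤n⇒m<n∨m≡n m+ℓ≤bv
    ... | inj₁ m+ℓ<bv = cong block (phaseState-aboveB v m+ℓ<bv)
    ... | inj₂ m+ℓ≡bv =
      trans (cong block (phaseState-atB v (sym m+ℓ≡bv))) (trans (proj₁ (pieceRep-spec cb v (sym m+ℓ≡bv) refl)) m+ℓ≡bv)

    module PhaseShaped = Shaped ℓ (m + ℓ) (<⇒≤ ℓ<m) (m≤m+n m ℓ) (phaseState ℓ ca cb)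
      phaseState-belowA phaseState-belowB phaseState-free

  -- The partition between two phases (α = β) and between the two final merges of a phase (α = β + 1).
  collapsed : ℕ → ℕ → Fin n → Fin n
  collapsed α β v =
    if block v <ᵇ α then hubA
    else if block v <ᵇ m then v
    else if block v <ᵇ m + β then hubB
    else if block v <ᵇ m + α then blockRep (m + β)
    else v

  module _ {α β : ℕ} (α≤m : α ≤ m) (β≤α : β ≤ α) where

    collapsed-mergedA : ∀ v → block v < α → collapsed α β v ≡ hubA
    collapsed-mergedA v bv<α rewrite <ᵇ-true bv<α = refl

    collapsed-freeA : ∀ v → α ≤ block v → block v < m → collapsed α β v ≡ v
    collapsed-freeA v α≤bv bv<m rewrite <ᵇ-false α≤bv | <ᵇ-true bv<m = refl

    collapsed-mergedB : ∀ v → m ≤ block v → block v < m + β → collapsed α β v ≡ hubB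
    collapsed-mergedB v m≤bv bv<m+β rewrite <ᵇ-false (≤-trans α≤m m≤bv) | <ᵇ-false m≤bv | <ᵇ-true bv<m+β = refl

    collapsed-pending : ∀ v → m + β ≤ block v → block v < m + α → collapsed α β v ≡ blockRep (m + β)
    collapsed-pending v m+β≤bv bv<m+α
      rewrite <ᵇ-false (≤-trans α≤m (≤-trans (m≤m+n m β) m+β≤bv)) | <ᵇ-false (≤-trans (m≤m+n m β) m+β≤bv)
            | <ᵇ-false m+β≤bv | <ᵇ-true bv<m+α = refl

    collapsed-freeB : ∀ v → m + α ≤ block v → collapsed α β v ≡ v
    collapsed-freeB v m+α≤bv
      rewrite <ᵇ-false (≤-trans α≤m (≤-trans (m≤m+n m α) m+α≤bv)) | <ᵇ-false (≤-trans (m≤m+n m α) m+α≤bv)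
            | <ᵇ-false (≤-trans (+-monoʳ-≤ m β≤α) m+α≤bv) | <ᵇ-false m+α≤bv = refl

    module _ (α≤1+β : α ≤ suc β) where

      collapsed-free : ∀ v → Free α (m + β) (block v) → block (collapsed α β v) ≡ block v
      collapsed-free v (α≤bv , inj₁ bv<m) = cong block (collapsed-freeA v α≤bv bv<m)
      collapsed-free v (_ , inj₂ m+β≤bv) with block v <? m + α
      ... | no bv≮m+α = cong block (collapsed-freeB v (≮⇒≥ bv≮m+α))
      ... | yes bv<m+α = trans (cong block (collapsed-pending v m+β≤bv bv<m+α)) (trans (block-blockRep m+β<2m) (sym bv≡m+β))
        where
          bv≡m+β : block v ≡ m + β
          bv≡m+β = ≤-antisym (+-cancelˡ-≤ 1 _ _ (subst (suc (block v) ≤_) (+-suc m β) (≤-trans bv<m+α (+-monoʳ-≤ m α≤1+β)))) m+β≤bv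
          m+β<2m : m + β < m + m
          m+β<2m = subst (_< m + m) bv≡m+β (block<2m v)

      module CollapsedShaped = Shaped α (m + β) α≤m (m≤m+n m β) (collapsed α β)
        collapsed-mergedA collapsed-mergedB collapsed-free

  D : ℕ
  D = 2 * k + 2

  singleton-parts-homogeneous : ∀ cls x y → (∀ z → cls z ≡ cls x → z ≡ x) → (∀ z → cls z ≡ cls y → z ≡ y) →
                                ¬ G.NonHom cls (cls x) (cls y)
  singleton-parts-homogeneous cls x y x-alone y-alone =
    singletons-homogeneous E x y (λ z z∈ → x-alone z (part cls z∈)) (λ z z∈ → y-alone z (part cls z∈))

  module CollapsedDegree {α β : ℕ} (α≤m : α ≤ m) (β≤α : β ≤ α) (α≤1+β : α ≤ suc β) where
    open CollapsedShaped α≤m β≤α α≤1+β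

    private
      cls : Fin n → Fin n
      cls = collapsed α β

      alone-A : ∀ x → α ≤ block x → block x < m → ∀ z → cls z ≡ cls x → z ≡ x
      alone-A x α≤bx bx<m = free-singleton x (α≤bx , inj₁ bx<m) λ z bz≡bx →
        collapsed-freeA α≤m β≤α z (subst (α ≤_) (sym bz≡bx) α≤bx) (subst (_< m) (sym bz≡bx) bx<m)

      alone-B : ∀ x → m + α ≤ block x → ∀ z → cls z ≡ cls x → z ≡ x
      alone-B x m+α≤bx = free-singleton x (≤-trans α≤m (≤-trans (m≤m+n m α) m+α≤bx) , inj₂ (≤-trans (+-monoʳ-≤ m β≤α) m+α≤bx))
        λ z bz≡bx → collapsed-freeB α≤m β≤α z (subst (m + α ≤_) (sym bz≡bx) m+α≤bx)

      degree-≤ : ∀ x₀ ys → length ys ≤ 2 → (∀ b → cls x₀ ≢ b → G.NonHom cls (cls x₀) b → b ∈ ys) →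
                 G.errDeg cls (cls x₀) ≤ D
      degree-≤ x₀ ys ys≤2 h = ≤-trans (G.errDeg-≤ cls (cls x₀) ys λ b _ → h b) (≤-trans ys≤2 (m≤n+m 2 (2 * k)))

      degree-hubA : ∀ x₀ → block x₀ < α → G.errDeg cls (cls x₀) ≤ D
      degree-hubA x₀ bx₀<α = degree-≤ x₀ (hubB ∷ blockRep (m + β) ∷ []) ≤-refl neighbour
        where
          neighbour : ∀ b → cls x₀ ≢ b → G.NonHom cls (cls x₀) b → b ∈ hubB ∷ blockRep (m + β) ∷ []
          neighbour b a≢b w with y , refl , m≤by , by<m+α ← hubA-neighbour x₀ b bx₀<α a≢b w with block y <? m + β
          ... | yes by<m+β = here (collapsed-mergedB α≤m β≤α y m≤by by<m+β)
          ... | no by≮m+β = there (here (collapsed-pending α≤m β≤α y (≮⇒≥ by≮m+β) by<m+α))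

      degree-hubB : ∀ x₀ → m ≤ block x₀ → block x₀ < m + β → G.errDeg cls (cls x₀) ≤ D
      degree-hubB x₀ m≤bx₀ bx₀<m+β = degree-≤ x₀ (hubA ∷ []) (s≤s z≤n) λ b a≢b w →
        let y , cy≡b , _ , m+by<m+β = hubB-neighbour x₀ b m≤bx₀ bx₀<m+β a≢b w
        in here (trans (sym cy≡b) (collapsed-mergedA α≤m β≤α y (<-≤-trans (+-cancelˡ-< m _ _ m+by<m+β) β≤α)))

      degree-singleton-A : ∀ x₀ → α ≤ block x₀ → block x₀ < m → G.errDeg cls (cls x₀) ≤ D
      degree-singleton-A x₀ α≤bx₀ bx₀<m = degree-≤ x₀ [] z≤n neighbour
        where
          neighbour : ∀ b → cls x₀ ≢ b → G.NonHom cls (cls x₀) b → b ∈ []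
          neighbour b a≢b w with free-neighbour x₀ b (α≤bx₀ , inj₁ bx₀<m) w
          ... | y , refl , inj₁ by≡bx₀ = ⊥-elim (singleton-parts-homogeneous cls x₀ y (alone-A x₀ α≤bx₀ bx₀<m)
                  (alone-A y (subst (α ≤_) (sym by≡bx₀) α≤bx₀) (subst (_< m) (sym by≡bx₀) bx₀<m)) w)
          ... | y , refl , inj₂ (inj₁ by≡m+bx₀) = ⊥-elim (singleton-parts-homogeneous cls x₀ y (alone-A x₀ α≤bx₀ bx₀<m)
                  (alone-B y (subst (m + α ≤_) (sym by≡m+bx₀) (+-monoʳ-≤ m α≤bx₀))) w)
          ... | y , refl , inj₂ (inj₂ bx₀≡m+by) = ⊥-elim (<⇒≱ bx₀<m (subst (m ≤_) (sym bx₀≡m+by) (m≤m+n m _)))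

      degree-pending : ∀ x₀ → m + β ≤ block x₀ → block x₀ < m + α → G.errDeg cls (cls x₀) ≤ D
      degree-pending x₀ m+β≤bx₀ bx₀<m+α = degree-≤ x₀ (hubA ∷ []) (s≤s z≤n) neighbour
        where
          neighbour : ∀ b → cls x₀ ≢ b → G.NonHom cls (cls x₀) b → b ∈ hubA ∷ []
          neighbour b a≢b w with free-neighbour x₀ b (≤-trans α≤m (≤-trans (m≤m+n m β) m+β≤bx₀) , inj₂ m+β≤bx₀) w
          ... | y , refl , inj₁ by≡bx₀ = ⊥-elim (a≢b (trans (collapsed-pending α≤m β≤α x₀ m+β≤bx₀ bx₀<m+α)
                  (sym (collapsed-pending α≤m β≤α y (subst (m + β ≤_) (sym by≡bx₀) m+β≤bx₀) (subst (_< m + α) (sym by≡bx₀) bx₀<m+α)))))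
          ... | y , refl , inj₂ (inj₁ by≡m+bx₀) = ⊥-elim (no-partner-above y x₀ (≤-trans (m≤m+n m β) m+β≤bx₀) by≡m+bx₀)
          ... | y , refl , inj₂ (inj₂ bx₀≡m+by) =
            here (collapsed-mergedA α≤m β≤α y (+-cancelˡ-< m _ _ (subst (_< m + α) bx₀≡m+by bx₀<m+α)))

      degree-singleton-B : ∀ x₀ → m + α ≤ block x₀ → G.errDeg cls (cls x₀) ≤ D
      degree-singleton-B x₀ m+α≤bx₀ = degree-≤ x₀ [] z≤n neighbour
        where
          m+β≤bx₀ = ≤-trans (+-monoʳ-≤ m β≤α) m+α≤bx₀
          neighbour : ∀ b → cls x₀ ≢ b → G.NonHom cls (cls x₀) b → b ∈ []
          neighbour b a≢b w with free-neighbour x₀ b (≤-trans α≤m (≤-trans (m≤m+n m β) m+β≤bx₀) , inj₂ m+β≤bx₀) w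
          ... | y , refl , inj₁ by≡bx₀ = ⊥-elim (singleton-parts-homogeneous cls x₀ y (alone-B x₀ m+α≤bx₀)
                  (alone-B y (subst (m + α ≤_) (sym by≡bx₀) m+α≤bx₀)) w)
          ... | y , refl , inj₂ (inj₁ by≡m+bx₀) = ⊥-elim (no-partner-above y x₀ (≤-trans (m≤m+n m β) m+β≤bx₀) by≡m+bx₀)
          ... | y , refl , inj₂ (inj₂ bx₀≡m+by) = ⊥-elim (singleton-parts-homogeneous cls x₀ y (alone-B x₀ m+α≤bx₀)
                  (alone-A y (+-cancelˡ-≤ m _ _ (subst (m + α ≤_) bx₀≡m+by m+α≤bx₀))
                              (+-cancelˡ-< m _ _ (subst (_< m + m) bx₀≡m+by (block<2m x₀)))) w)

      degree : ∀ x₀ → Zone α (m + β) (block x₀) → G.errDeg cls (cls x₀) ≤ D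
      degree x₀ (mergedA bx₀<α) = degree-hubA x₀ bx₀<α
      degree x₀ (mergedB m≤bx₀ bx₀<m+β) = degree-hubB x₀ m≤bx₀ bx₀<m+β
      degree x₀ (freeA α≤bx₀ bx₀<m) = degree-singleton-A x₀ α≤bx₀ bx₀<m
      degree x₀ (freeB m+β≤bx₀) with block x₀ <? m + α
      ... | yes bx₀<m+α = degree-pending x₀ m+β≤bx₀ bx₀<m+α
      ... | no bx₀≮m+α = degree-singleton-B x₀ (≮⇒≥ bx₀≮m+α)

    collapsed-deg : G.ErrDegAtMost D (collapsed α β)
    collapsed-deg a occ with x₀ , _ , refl ← G.occurs⁻ cls a occ = degree x₀ (zone α (m + β) (block x₀))

  -- In phase ℓ the local labellings are either equal or one merge apart: ca = f ∘ cb, where f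
  -- fixes every label of cb except b₀.
  module PhaseDegree (i : Fin m) {ℓ : ℕ} (i≡ℓ : toℕ i ≡ ℓ) (ℓ<m : ℓ < m) (ca cb f : Fin n → Fin n) (b₀ : Fin n)
    (ca-deg : L.ErrDegAtMost i k ca) (cb-deg : L.ErrDegAtMost i k cb)
    (ca≡f∘cb : ∀ v → inAB m blk i v ≡ true → ca v ≡ f (cb v))
    (f-fixes : ∀ v → inAB m blk i v ≡ true → cb v ≡ f (cb v) ⊎ cb v ≡ b₀) where

    open PhaseShaped ℓ<m ca cb

    private
      cls pA pB : Fin n → Fin n
      cls = phaseState ℓ ca cb
      pA = pieceRep ca ℓ
      pB = pieceRep cb (m + ℓ)

      inS-atA : ∀ v → block v ≡ ℓ → inAB m blk i v ≡ true
      inS-atA = inAB-atA i i≡ℓ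

      inS-atB : ∀ v → block v ≡ m + ℓ → inAB m blk i v ≡ true
      inS-atB = inAB-atB i i≡ℓ

      free-atA : ∀ {b} → b ≡ ℓ → Free ℓ (m + ℓ) b
      free-atA b≡ℓ = ≤-reflexive (sym b≡ℓ) , inj₁ (subst (_< m) (sym b≡ℓ) ℓ<m)

      free-atB : ∀ {b} → b ≡ m + ℓ → Free ℓ (m + ℓ) b
      free-atB b≡m+ℓ = subst (ℓ ≤_) (sym b≡m+ℓ) (m≤n+m ℓ m) , inj₂ (≤-reflexive (sym b≡m+ℓ))

      cls-atA : ∀ y → block y ≡ ℓ → cls y ≡ pA (ca y)
      cls-atA = phaseState-atA ℓ<m ca cb

      cls-atB : ∀ y → block y ≡ m + ℓ → cls y ≡ pB (cb y)
      cls-atB = phaseState-atB ℓ<m ca cb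

      part-atA⊆ca : ∀ z z′ → block z ≡ ℓ → cls z′ ≡ cls z → L.inPart i ca (ca z) z′ ≡ true
      part-atA⊆ca z z′ bz≡ℓ same = L.inPart⁺ i ca (inS-atA z′ bz′≡ℓ)
        (trans (sym (proj₂ (pieceRep-spec ca z′ bz′≡ℓ refl)))
          (trans (cong ca (trans (sym (cls-atA z′ bz′≡ℓ)) (trans same (cls-atA z bz≡ℓ))))
            (proj₂ (pieceRep-spec ca z bz≡ℓ refl))))
        where bz′≡ℓ = trans (in-free z z′ (free-atA bz≡ℓ) (cong block same)) bz≡ℓ

      part-atB⊆cb : ∀ z z′ → block z ≡ m + ℓ → cls z′ ≡ cls z → L.inPart i cb (cb z) z′ ≡ true
      part-atB⊆cb z z′ bz≡m+ℓ same = L.inPart⁺ i cb (inS-atB z′ bz′≡m+ℓ)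
        (trans (sym (proj₂ (pieceRep-spec cb z′ bz′≡m+ℓ refl)))
          (trans (cong cb (trans (sym (cls-atB z′ bz′≡m+ℓ)) (trans same (cls-atB z bz≡m+ℓ))))
            (proj₂ (pieceRep-spec cb z bz≡m+ℓ refl))))
        where bz′≡m+ℓ = trans (in-free z z′ (free-atB bz≡m+ℓ) (cong block same)) bz≡m+ℓ

      part-atB⊆ca : ∀ z z′ → block z ≡ m + ℓ → cls z′ ≡ cls z → L.inPart i ca (ca z) z′ ≡ true
      part-atB⊆ca z z′ bz≡m+ℓ same with s , cbz′≡cbz ← L.inPart⁻ i cb (cb z) z′ (part-atB⊆cb z z′ bz≡m+ℓ same) =
        L.inPart⁺ i ca s (trans (ca≡f∘cb z′ s) (trans (cong f cbz′≡cbz) (sym (ca≡f∘cb z (inS-atB z bz≡m+ℓ)))))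

      localise : ∀ c {a b s t} → (∀ z → cls z ≡ a → L.inPart i c s z ≡ true) → (∀ z → cls z ≡ b → L.inPart i c t z ≡ true) →
                 G.NonHom cls a b → L.NonHom i c s t
      localise c a⊆s b⊆t = NonHomogeneous-mono E (λ z z∈a → a⊆s z (part cls z∈a)) (λ z z∈b → b⊆t z (part cls z∈b))

      local-neighbour : ∀ c {s t} y → inAB m blk i y ≡ true → c y ≡ t → s ≢ t → L.NonHom i c s t →
                        t ∈ L.neighbours i c s
      local-neighbour c {s} {t} y y∈S cy≡t s≢t w = L.∈-neighbours i c s t (L.occurs⁺ i c y y∈S cy≡t) s≢t w

      alone-A : ∀ x → ℓ < block x → block x < m → ∀ z → cls z ≡ cls x → z ≡ x
      alone-A x ℓ<bx bx<m = free-singleton x (<⇒≤ ℓ<bx , inj₁ bx<m) λ z bz≡bx →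
        phaseState-aboveA ℓ<m ca cb z (subst (ℓ <_) (sym bz≡bx) ℓ<bx) (subst (_< m) (sym bz≡bx) bx<m)

      alone-B : ∀ x → m + ℓ < block x → ∀ z → cls z ≡ cls x → z ≡ x
      alone-B x m+ℓ<bx = free-singleton x (≤-trans (m≤n+m ℓ m) (<⇒≤ m+ℓ<bx) , inj₂ (<⇒≤ m+ℓ<bx)) λ z bz≡bx →
        phaseState-aboveB ℓ<m ca cb z (subst (m + ℓ <_) (sym bz≡bx) m+ℓ<bx)

      degree-≤ : ∀ x₀ ys → length ys ≤ D → (∀ b → cls x₀ ≢ b → G.NonHom cls (cls x₀) b → b ∈ ys) →
                 G.errDeg cls (cls x₀) ≤ D
      degree-≤ x₀ ys ys≤D h = ≤-trans (G.errDeg-≤ cls (cls x₀) ys λ b _ → h b) ys≤D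

      1≤D : 1 ≤ D
      1≤D = ≤-trans (s≤s z≤n) (m≤n+m 2 (2 * k))

      two-lists≤D : ∀ (xs ys zs : List (Fin n)) {g h : Fin n → Fin n} → length xs ≤ k → length ys ≤ k → length zs ≤ 2 →
                    length (map g xs ++ map h ys ++ zs) ≤ D
      two-lists≤D xs ys zs {g} {h} xs≤k ys≤k zs≤2 = begin
        length (map g xs ++ map h ys ++ zs)            ≡⟨ length-++ (map g xs) ⟩
        length (map g xs) + length (map h ys ++ zs)    ≡⟨ cong₂ _+_ (length-map g xs) (length-++ (map h ys)) ⟩
        length xs + (length (map h ys) + length zs)    ≡⟨ cong (λ j → length xs + (j + length zs)) (length-map h ys) ⟩
        length xs + (length ys + length zs)            ≤⟨ +-mono-≤ xs≤k (+-mono-≤ ys≤k zs≤2) ⟩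
        k + (k + 2)                                    ≡⟨ sym (+-assoc k k 2) ⟩
        k + k + 2                                      ≡⟨ cong (λ j → k + j + 2) (sym (+-identityʳ k)) ⟩
        D                                              ∎
        where open ≤-Reasoning

      degree-singleton-A : ∀ x₀ → ℓ < block x₀ → block x₀ < m → G.errDeg cls (cls x₀) ≤ D
      degree-singleton-A x₀ ℓ<bx₀ bx₀<m = degree-≤ x₀ [] z≤n neighbour
        where
          neighbour : ∀ b → cls x₀ ≢ b → G.NonHom cls (cls x₀) b → b ∈ []
          neighbour b a≢b w with free-neighbour x₀ b (<⇒≤ ℓ<bx₀ , inj₁ bx₀<m) w
          ... | y , refl , inj₁ by≡bx₀ = ⊥-elim (singleton-parts-homogeneous cls x₀ y (alone-A x₀ ℓ<bx₀ bx₀<m)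
                  (alone-A y (subst (ℓ <_) (sym by≡bx₀) ℓ<bx₀) (subst (_< m) (sym by≡bx₀) bx₀<m)) w)
          ... | y , refl , inj₂ (inj₁ by≡m+bx₀) = ⊥-elim (singleton-parts-homogeneous cls x₀ y (alone-A x₀ ℓ<bx₀ bx₀<m)
                  (alone-B y (subst (m + ℓ <_) (sym by≡m+bx₀) (+-monoʳ-< m ℓ<bx₀))) w)
          ... | y , refl , inj₂ (inj₂ bx₀≡m+by) = ⊥-elim (<⇒≱ bx₀<m (subst (m ≤_) (sym bx₀≡m+by) (m≤m+n m _)))

      degree-singleton-B : ∀ x₀ → m + ℓ < block x₀ → G.errDeg cls (cls x₀) ≤ D
      degree-singleton-B x₀ m+ℓ<bx₀ = degree-≤ x₀ [] z≤n neighbour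
        where
          neighbour : ∀ b → cls x₀ ≢ b → G.NonHom cls (cls x₀) b → b ∈ []
          neighbour b a≢b w with free-neighbour x₀ b (≤-trans (m≤n+m ℓ m) (<⇒≤ m+ℓ<bx₀) , inj₂ (<⇒≤ m+ℓ<bx₀)) w
          ... | y , refl , inj₁ by≡bx₀ = ⊥-elim (singleton-parts-homogeneous cls x₀ y (alone-B x₀ m+ℓ<bx₀)
                  (alone-B y (subst (m + ℓ <_) (sym by≡bx₀) m+ℓ<bx₀)) w)
          ... | y , refl , inj₂ (inj₁ by≡m+bx₀) = ⊥-elim (no-partner-above y x₀ (≤-trans (m≤m+n m ℓ) (<⇒≤ m+ℓ<bx₀)) by≡m+bx₀)
          ... | y , refl , inj₂ (inj₂ bx₀≡m+by) = ⊥-elim (singleton-parts-homogeneous cls x₀ y (alone-B x₀ m+ℓ<bx₀)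
                  (alone-A y (+-cancelˡ-< m _ _ (subst (m + ℓ <_) bx₀≡m+by m+ℓ<bx₀))
                              (+-cancelˡ-< m _ _ (subst (_< m + m) bx₀≡m+by (block<2m x₀)))) w)

      degree-piece-A : ∀ x₀ → block x₀ ≡ ℓ → G.errDeg cls (cls x₀) ≤ D
      degree-piece-A x₀ bx₀≡ℓ = degree-≤ x₀ LA (two-lists≤D Na Na _ Na≤k Na≤k ≤-refl) neighbour
        where
          t₀ : Fin n
          t₀ = ca x₀
          Na LA : List (Fin n)
          Na = L.neighbours i ca t₀
          LA = map pA Na ++ map pB Na ++ pB t₀ ∷ pB b₀ ∷ []
          Na≤k : length Na ≤ k
          Na≤k = ca-deg t₀ (L.occurs⁺ i ca x₀ (inS-atA x₀ bx₀≡ℓ) refl)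
          neighbour : ∀ b → cls x₀ ≢ b → G.NonHom cls (cls x₀) b → b ∈ LA
          neighbour b a≢b w with free-neighbour x₀ b (free-atA bx₀≡ℓ) w
          ... | y , refl , inj₁ by≡bx₀ = ∈-++⁺ˡ (subst (_∈ map pA Na) (sym (cls-atA y by≡ℓ)) (∈-map⁺ pA caY∈Na))
            where
              by≡ℓ = trans by≡bx₀ bx₀≡ℓ
              caY∈Na = local-neighbour ca y (inS-atA y by≡ℓ) refl
                (λ t₀≡ → a≢b (trans (cls-atA x₀ bx₀≡ℓ) (trans (cong pA t₀≡) (sym (cls-atA y by≡ℓ)))))
                (localise ca (λ z → part-atA⊆ca x₀ z bx₀≡ℓ) (λ z → part-atA⊆ca y z by≡ℓ) w)
          ... | y , refl , inj₂ (inj₁ by≡m+bx₀) = partner (trans by≡m+bx₀ (cong (m +_) bx₀≡ℓ))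
            where
              partner : block y ≡ m + ℓ → cls y ∈ LA
              partner by≡m+ℓ with f-fixes y (inS-atB y by≡m+ℓ) | ca y ≟ t₀
              ... | inj₂ cby≡b₀ | _ =
                ∈-++⁺ʳ (map pA Na) (∈-++⁺ʳ (map pB Na) (there (here (trans (cls-atB y by≡m+ℓ) (cong pB cby≡b₀)))))
              ... | inj₁ fixed | yes cay≡t₀ =
                ∈-++⁺ʳ (map pA Na) (∈-++⁺ʳ (map pB Na) (here (trans (cls-atB y by≡m+ℓ) (cong pB (trans cby≡cay cay≡t₀)))))
                where cby≡cay = trans fixed (sym (ca≡f∘cb y (inS-atB y by≡m+ℓ)))
              ... | inj₁ fixed | no cay≢t₀ =
                ∈-++⁺ʳ (map pA Na) (∈-++⁺ˡ (subst (_∈ map pB Na) (sym (trans (cls-atB y by≡m+ℓ) (cong pB cby≡cay))) (∈-map⁺ pB caY∈Na)))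
                where
                  cby≡cay = trans fixed (sym (ca≡f∘cb y (inS-atB y by≡m+ℓ)))
                  caY∈Na = local-neighbour ca y (inS-atB y by≡m+ℓ) refl (λ t₀≡ → cay≢t₀ (sym t₀≡))
                    (localise ca (λ z → part-atA⊆ca x₀ z bx₀≡ℓ) (λ z → part-atB⊆ca y z by≡m+ℓ) w)
          ... | y , refl , inj₂ (inj₂ bx₀≡m+by) =
            ⊥-elim (<⇒≱ (subst (_< m) (sym bx₀≡ℓ) ℓ<m) (subst (m ≤_) (sym bx₀≡m+by) (m≤m+n m _)))

      degree-piece-B : ∀ x₀ → block x₀ ≡ m + ℓ → G.errDeg cls (cls x₀) ≤ D
      degree-piece-B x₀ bx₀≡m+ℓ = degree-≤ x₀ LB (two-lists≤D Nb Na _ Nb≤k Na≤k (s≤s z≤n)) neighbour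
        where
          u₀ s₀ : Fin n
          u₀ = cb x₀
          s₀ = ca x₀
          Nb Na LB : List (Fin n)
          Nb = L.neighbours i cb u₀
          Na = L.neighbours i ca s₀
          LB = map pB Nb ++ map pA Na ++ pA s₀ ∷ []
          Nb≤k : length Nb ≤ k
          Nb≤k = cb-deg u₀ (L.occurs⁺ i cb x₀ (inS-atB x₀ bx₀≡m+ℓ) refl)
          Na≤k : length Na ≤ k
          Na≤k = ca-deg s₀ (L.occurs⁺ i ca x₀ (inS-atB x₀ bx₀≡m+ℓ) refl)
          neighbour : ∀ b → cls x₀ ≢ b → G.NonHom cls (cls x₀) b → b ∈ LB
          neighbour b a≢b w with free-neighbour x₀ b (free-atB bx₀≡m+ℓ) w
          ... | y , refl , inj₁ by≡bx₀ = ∈-++⁺ˡ (subst (_∈ map pB Nb) (sym (cls-atB y by≡m+ℓ)) (∈-map⁺ pB cbY∈Nb))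
            where
              by≡m+ℓ = trans by≡bx₀ bx₀≡m+ℓ
              cbY∈Nb = local-neighbour cb y (inS-atB y by≡m+ℓ) refl
                (λ u₀≡ → a≢b (trans (cls-atB x₀ bx₀≡m+ℓ) (trans (cong pB u₀≡) (sym (cls-atB y by≡m+ℓ)))))
                (localise cb (λ z → part-atB⊆cb x₀ z bx₀≡m+ℓ) (λ z → part-atB⊆cb y z by≡m+ℓ) w)
          ... | y , refl , inj₂ (inj₁ by≡m+bx₀) =
            ⊥-elim (no-partner-above y x₀ (subst (m ≤_) (sym bx₀≡m+ℓ) (m≤m+n m ℓ)) by≡m+bx₀)
          ... | y , refl , inj₂ (inj₂ bx₀≡m+by) = partner (+-cancelˡ-≡ m _ _ (trans (sym bx₀≡m+by) bx₀≡m+ℓ))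
            where
              partner : block y ≡ ℓ → cls y ∈ LB
              partner by≡ℓ with ca y ≟ s₀
              ... | yes cay≡s₀ = ∈-++⁺ʳ (map pB Nb) (∈-++⁺ʳ (map pA Na) (here (trans (cls-atA y by≡ℓ) (cong pA cay≡s₀))))
              ... | no cay≢s₀ = ∈-++⁺ʳ (map pB Nb) (∈-++⁺ˡ (subst (_∈ map pA Na) (sym (cls-atA y by≡ℓ)) (∈-map⁺ pA caY∈Na)))
                where
                  caY∈Na = local-neighbour ca y (inS-atA y by≡ℓ) refl (λ s₀≡ → cay≢s₀ (sym s₀≡))
                    (localise ca (λ z → part-atB⊆ca x₀ z bx₀≡m+ℓ) (λ z → part-atA⊆ca y z by≡ℓ) w)

      degree-hubA : ∀ x₀ → block x₀ < ℓ → G.errDeg cls (cls x₀) ≤ D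
      degree-hubA x₀ bx₀<ℓ = degree-≤ x₀ (hubB ∷ []) 1≤D λ b a≢b w →
        let y , cy≡b , m≤by , by<m+ℓ = hubA-neighbour x₀ b bx₀<ℓ a≢b w
        in here (trans (sym cy≡b) (phaseState-belowB ℓ<m ca cb y m≤by by<m+ℓ))

      degree-hubB : ∀ x₀ → m ≤ block x₀ → block x₀ < m + ℓ → G.errDeg cls (cls x₀) ≤ D
      degree-hubB x₀ m≤bx₀ bx₀<m+ℓ = degree-≤ x₀ (hubA ∷ []) 1≤D λ b a≢b w →
        let y , cy≡b , _ , m+by<m+ℓ = hubB-neighbour x₀ b m≤bx₀ bx₀<m+ℓ a≢b w
        in here (trans (sym cy≡b) (phaseState-belowA ℓ<m ca cb y (+-cancelˡ-< m _ _ m+by<m+ℓ)))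

      degree : ∀ x₀ → Zone ℓ (m + ℓ) (block x₀) → G.errDeg cls (cls x₀) ≤ D
      degree x₀ (mergedA bx₀<ℓ) = degree-hubA x₀ bx₀<ℓ
      degree x₀ (mergedB m≤bx₀ bx₀<m+ℓ) = degree-hubB x₀ m≤bx₀ bx₀<m+ℓ
      degree x₀ (freeA ℓ≤bx₀ bx₀<m) with m≤n⇒m<n∨m≡n ℓ≤bx₀
      ... | inj₁ ℓ<bx₀ = degree-singleton-A x₀ ℓ<bx₀ bx₀<m
      ... | inj₂ ℓ≡bx₀ = degree-piece-A x₀ (sym ℓ≡bx₀)
      degree x₀ (freeB m+ℓ≤bx₀) with m≤n⇒m<n∨m≡n m+ℓ≤bx₀
      ... | inj₁ m+ℓ<bx₀ = degree-singleton-B x₀ m+ℓ<bx₀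
      ... | inj₂ m+ℓ≡bx₀ = degree-piece-B x₀ (sym m+ℓ≡bx₀)

    phaseState-deg : G.ErrDegAtMost D (phaseState ℓ ca cb)
    phaseState-deg a occ with x₀ , _ , refl ← G.occurs⁻ cls a occ = degree x₀ (zone ℓ (m + ℓ) (block x₀))

  -- A local merge of part b into part a only affects the pieces of one block β.
  module LiftMerge {β : ℕ} {g g′ cOld cNew : Fin n → Fin n} {a b : Fin n} (a≢b : a ≢ b)
    (g-β : ∀ v → block v ≡ β → g v ≡ pieceRep cOld β (cOld v))
    (g-β⁻ : ∀ v → block (g v) ≡ β → block v ≡ β)
    (g′-other : ∀ v → block v ≢ β → g′ v ≡ g v)
    (g′-β : ∀ v → block v ≡ β → g′ v ≡ pieceRep cNew β (cNew v))
    (merged : ∀ v → block v ≡ β → cNew v ≡ (if cOld v == b then a else cOld v)) where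

    private
      A B N : Fin n
      A = pieceRep cOld β a
      B = pieceRep cOld β b
      N = pieceRep cNew β a

      has : Fin n → Fin n → Bool
      has t w = (block w ≡ᵇ β) ∧ (cOld w == t)

      cNew-b : ∀ v → block v ≡ β → cOld v ≡ b → cNew v ≡ a
      cNew-b v bv≡β cv≡b rewrite merged v bv≡β | ≡⇒== cv≡b = refl

      cNew-other : ∀ v → block v ≡ β → cOld v ≢ b → cNew v ≡ cOld v
      cNew-other v bv≡β cv≢b rewrite merged v bv≡β | ≢⇒==false cv≢b = refl

      cOld-g : ∀ v → block v ≡ β → cOld (g v) ≡ cOld v
      cOld-g v bv≡β = trans (cong cOld (g-β v bv≡β)) (proj₂ (pieceRep-spec cOld v bv≡β refl))

      g′-ab : ∀ v → block v ≡ β → cOld v ≡ a ⊎ cOld v ≡ b → g′ v ≡ N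
      g′-ab v bv≡β (inj₁ cv≡a) =
        trans (g′-β v bv≡β) (cong (pieceRep cNew β) (trans (cNew-other v bv≡β λ cv≡b → a≢b (trans (sym cv≡a) cv≡b)) cv≡a))
      g′-ab v bv≡β (inj₂ cv≡b) = trans (g′-β v bv≡β) (cong (pieceRep cNew β) (cNew-b v bv≡β cv≡b))

      g′-untouched : ∀ v → block v ≡ β → cOld v ≢ a → cOld v ≢ b → g′ v ≡ g v
      g′-untouched v bv≡β cv≢a cv≢b =
        trans (g′-β v bv≡β) (trans (cong (pieceRep cNew β) (cNew-other v bv≡β cv≢b))
          (trans (pieceRep-cong cNew cOld β (cOld v) (cOld v) same) (sym (g-β v bv≡β))))
        where
          same : ∀ w → block w ≡ β → (cNew w ≡ cOld v → cOld w ≡ cOld v) × (cOld w ≡ cOld v → cNew w ≡ cOld v)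
          same w bw≡β = forward , λ cw≡cv → trans (cNew-other w bw≡β λ cw≡b → cv≢b (trans (sym cw≡cv) cw≡b)) cw≡cv
            where
              forward : cNew w ≡ cOld v → cOld w ≡ cOld v
              forward cnw≡cv with cOld w ≟ b
              ... | yes cw≡b = ⊥-elim (cv≢a (trans (sym cnw≡cv) (cNew-b w bw≡β cw≡b)))
              ... | no cw≢b = trans (sym (cNew-other w bw≡β cw≢b)) cnw≡cv

      without-b : (∀ w → block w ≡ β → cOld w ≢ b) → g′ G.≐ g
      without-b no-b v _ with block v ≟ℕ β
      ... | no bv≢β = g′-other v bv≢β
      ... | yes bv≡β = trans (g′-β v bv≡β) (trans (cong (pieceRep cNew β) (cNew-other v bv≡β (no-b v bv≡β)))
          (trans (pieceRep-cong cNew cOld β (cOld v) (cOld v) same) (sym (g-β v bv≡β))))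
        where
          same : ∀ w → block w ≡ β → (cNew w ≡ cOld v → cOld w ≡ cOld v) × (cOld w ≡ cOld v → cNew w ≡ cOld v)
          same w bw≡β = (λ e → trans (sym (cNew-other w bw≡β (no-b w bw≡β))) e) , (λ e → trans (cNew-other w bw≡β (no-b w bw≡β)) e)

      without-a : (∀ w → block w ≡ β → cOld w ≢ a) → g′ G.≐ g
      without-a no-a v _ with block v ≟ℕ β
      ... | no bv≢β = g′-other v bv≢β
      ... | yes bv≡β with cOld v ≟ b
      ...   | no cv≢b = g′-untouched v bv≡β (no-a v bv≡β) cv≢b
      ...   | yes cv≡b = trans (g′-ab v bv≡β (inj₂ cv≡b))
                (trans (pieceRep-cong cNew cOld β a b same) (trans (cong (pieceRep cOld β) (sym cv≡b)) (sym (g-β v bv≡β))))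
        where
          same : ∀ w → block w ≡ β → (cNew w ≡ a → cOld w ≡ b) × (cOld w ≡ b → cNew w ≡ a)
          same w bw≡β = forward , cNew-b w bw≡β
            where
              forward : cNew w ≡ a → cOld w ≡ b
              forward cnw≡a with cOld w ≟ b
              ... | yes cw≡b = cw≡b
              ... | no cw≢b = ⊥-elim (no-a w bw≡β (trans (sym (cNew-other w bw≡β cw≢b)) cnw≡a))

      absent : ∀ t → anyV (has t) ≡ false → ∀ w → block w ≡ β → cOld w ≢ t
      absent t none w bw≡β cw≡t =
        subst (_≢ true) (sym (anyV-false⁻ (has t) none w)) (λ ()) (∧-true⁺ (≡ᵇ-true bw≡β) (≡⇒== cw≡t))

      has⁻ : ∀ t w → has t w ≡ true → block w ≡ β × cOld w ≡ t
      has⁻ t w has-w = let bw≡ᵇβ , cw==t = ∧-true⁻ {block w ≡ᵇ β} has-w in ≡ᵇ-true⇒≡ bw≡ᵇβ , ==⇒≡ cw==t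

      g-rep : ∀ t w → has t w ≡ true → g w ≡ pieceRep cOld β t
      g-rep t w has-w = let bw≡β , cw≡t = has⁻ t w has-w in trans (g-β w bw≡β) (cong (pieceRep cOld β) cw≡t)

      g⁻-rep : ∀ t w → has t w ≡ true → ∀ v → g v ≡ pieceRep cOld β t → block v ≡ β × cOld v ≡ t
      g⁻-rep t w has-w v gv≡rep = bv≡β , trans (sym (cOld-g v bv≡β)) (trans (cong cOld gv≡rep) (proj₂ spec))
        where
          spec = pieceRep-spec cOld w (proj₁ (has⁻ t w has-w)) (proj₂ (has⁻ t w has-w))
          bv≡β = g-β⁻ v (trans (cong block gv≡rep) (proj₁ spec))

      g-ab : ∀ v → block v ≡ β → cOld v ≡ a ⊎ cOld v ≡ b → g v ≡ A ⊎ g v ≡ B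
      g-ab v bv≡β (inj₁ cv≡a) = inj₁ (trans (g-β v bv≡β) (cong (pieceRep cOld β) cv≡a))
      g-ab v bv≡β (inj₂ cv≡b) = inj₂ (trans (g-β v bv≡β) (cong (pieceRep cOld β) cv≡b))

      has-ab : ∀ w → ((block w ≡ᵇ β) ∧ (cNew w == a)) ≡ (has a w ∨ has b w)
      has-ab w with block w ≡ᵇ β in bw≡ᵇβ
      ... | false = refl
      ... | true with cOld w ≟ b
      ...   | yes cw≡b rewrite cNew-b w (≡ᵇ-true⇒≡ bw≡ᵇβ) cw≡b | ≡⇒== {a = a} refl = sym (∨-zeroʳ _)
      ...   | no cw≢b rewrite cNew-other w (≡ᵇ-true⇒≡ bw≡ᵇβ) cw≢b = sym (∨-identityʳ _)

      N≡A⊎N≡B : N ≡ A ⊎ N ≡ B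
      N≡A⊎N≡B with first-∨ (has a) (has b) someVertex
      ... | inj₁ eq = inj₁ (trans (first-cong _ _ someVertex has-ab) eq)
      ... | inj₂ eq = inj₂ (trans (first-cong _ _ someVertex has-ab) eq)

      equation-outside : ∀ Y v → g′ v ≡ g v → g v ≢ Y → g′ v ≡ (if g v == Y then N else g v)
      equation-outside Y v g′v≡gv gv≢Y rewrite ≢⇒==false gv≢Y = g′v≡gv

      equation-inside : ∀ Y v → g v ≡ Y ⊎ g v ≡ N → g′ v ≡ N → g′ v ≡ (if g v == Y then N else g v)
      equation-inside Y v (inj₁ refl) g′v≡N rewrite ≡⇒== {a = g v} refl = g′v≡N
      equation-inside Y v (inj₂ gv≡N) g′v≡N rewrite gv≡N = trans g′v≡N (if-same (N == Y))
        where
          if-same : ∀ c → N ≡ (if c then N else N)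
          if-same true = refl
          if-same false = refl

      merge-equation : ∀ Y → (∀ v → block v ≡ β → cOld v ≡ a ⊎ cOld v ≡ b → g v ≡ Y ⊎ g v ≡ N) →
                       (∀ v → g v ≡ Y → block v ≡ β × (cOld v ≡ a ⊎ cOld v ≡ b)) →
                       ∀ v → g′ v ≡ (if g v == Y then N else g v)
      merge-equation Y ab⇒Y⊎N Y⇒ab v with block v ≟ℕ β
      ... | no bv≢β = equation-outside Y v (g′-other v bv≢β) (λ gv≡Y → bv≢β (proj₁ (Y⇒ab v gv≡Y)))
      ... | yes bv≡β with cOld v ≟ a | cOld v ≟ b
      ...   | yes cv≡a | _ = equation-inside Y v (ab⇒Y⊎N v bv≡β (inj₁ cv≡a)) (g′-ab v bv≡β (inj₁ cv≡a))
      ...   | no _ | yes cv≡b = equation-inside Y v (ab⇒Y⊎N v bv≡β (inj₂ cv≡b)) (g′-ab v bv≡β (inj₂ cv≡b))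
      ...   | no cv≢a | no cv≢b = equation-outside Y v (g′-untouched v bv≡β cv≢a cv≢b)
                                    (λ gv≡Y → [ cv≢a , cv≢b ] (proj₂ (Y⇒ab v gv≡Y)))

      -- The merged part keeps the label of one of the two pieces, and the other piece is merged into it.
      both-present : ∀ va vb → has a va ≡ true → has b vb ≡ true →
                     G.ErrDegAtMost D g → G.SeqFrom D g′ → G.SeqFrom D g
      both-present va vb has-va has-vb deg rest with N≡A⊎N≡B
      ... | inj₁ N≡A =
        G.merge-or-stay N B deg
          (G.occurs⁺ g va refl (trans (g-rep a va has-va) (sym N≡A))) (G.occurs⁺ g vb refl (g-rep b vb has-vb))
          (λ v _ → merge-equation B (λ v bv≡β ab → swap (map₁ (λ gv≡A → trans gv≡A (sym N≡A)) (g-ab v bv≡β ab)))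
                                    (λ v gv≡B → let bv≡β , cv≡b = g⁻-rep b vb has-vb v gv≡B in bv≡β , inj₂ cv≡b) v)
          rest
      ... | inj₂ N≡B =
        G.merge-or-stay N A deg
          (G.occurs⁺ g vb refl (trans (g-rep b vb has-vb) (sym N≡B))) (G.occurs⁺ g va refl (g-rep a va has-va))
          (λ v _ → merge-equation A (λ v bv≡β ab → map₂ (λ gv≡B → trans gv≡B (sym N≡B)) (g-ab v bv≡β ab))
                                    (λ v gv≡A → let bv≡β , cv≡a = g⁻-rep a va has-va v gv≡A in bv≡β , inj₁ cv≡a) v)
          rest

    -- If a or b does not occur in block β, the global labelling does not change at all.
    lift-merge : G.ErrDegAtMost D g → G.SeqFrom D g′ → G.SeqFrom D g
    lift-merge deg rest with anyV (has a) in some-a | anyV (has b) in some-b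
    ... | _ | false = G.SeqFrom-resp (without-b (absent b some-b)) rest
    ... | false | true = G.SeqFrom-resp (without-a (absent a some-a)) rest
    ... | true | true =
      let va , has-va = anyV⁻ (has a) some-a ; vb , has-vb = anyV⁻ (has b) some-b
      in both-present va vb has-va has-vb deg rest

  private
    unmerged : ∀ {x y} z → block x ≢ block y → x ≡ (if x == y then z else x)
    unmerged z bx≢by rewrite ≢⇒==false (λ x≡y → bx≢by (cong block x≡y)) = refl

    merged-self : ∀ (x z : Fin n) → z ≡ (if x == x then z else x)
    merged-self x z rewrite ≡⇒== {a = x} refl = refl

    if-same : ∀ c (x : Fin n) → x ≡ (if c then x else x)
    if-same true x = refl
    if-same false x = refl

  phaseState-sameA : ∀ ℓ ca ca′ cb v → block v ≢ ℓ → phaseState ℓ ca cb v ≡ phaseState ℓ ca′ cb v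
  phaseState-sameA ℓ ca ca′ cb v bv≢ℓ with block v <ᵇ ℓ
  ... | true = refl
  ... | false rewrite ≡ᵇ-false bv≢ℓ = refl

  phaseState-sameB : ∀ ℓ ca cb cb′ v → block v ≢ m + ℓ → phaseState ℓ ca cb v ≡ phaseState ℓ ca cb′ v
  phaseState-sameB ℓ ca cb cb′ v bv≢m+ℓ with block v <ᵇ ℓ | block v ≡ᵇ ℓ | block v <ᵇ m | block v <ᵇ m + ℓ
  ... | true | _ | _ | _ = refl
  ... | false | true | _ | _ = refl
  ... | false | false | true | _ = refl
  ... | false | false | false | true = refl
  ... | false | false | false | false rewrite ≡ᵇ-false bv≢m+ℓ = refl

  module Phase (i : Fin m) {ℓ : ℕ} (i≡ℓ : toℕ i ≡ ℓ) (ℓ<m : ℓ < m) where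

    private
      module LS = L i

      atA⁻ : ∀ ca cb v → block (phaseState ℓ ca cb v) ≡ ℓ → block v ≡ ℓ
      atA⁻ ca cb v bgv≡ℓ =
        trans (sym (PhaseShaped.free⁻ ℓ<m ca cb v (≤-reflexive (sym bgv≡ℓ) , inj₁ (subst (_< m) (sym bgv≡ℓ) ℓ<m)))) bgv≡ℓ

      atB⁻ : ∀ ca cb v → block (phaseState ℓ ca cb v) ≡ m + ℓ → block v ≡ m + ℓ
      atB⁻ ca cb v bgv≡m+ℓ =
        trans (sym (PhaseShaped.free⁻ ℓ<m ca cb v (subst (ℓ ≤_) (sym bgv≡m+ℓ) (m≤n+m ℓ m) , inj₂ (≤-reflexive (sym bgv≡m+ℓ))))) bgv≡m+ℓ

      rename : Fin n → Fin n → Fin n → Fin n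
      rename a b x = if x == b then a else x

      rename-fixes : ∀ a b x → x ≡ rename a b x ⊎ x ≡ b
      rename-fixes a b x with x ≟ b
      ... | yes x≡b = inj₂ x≡b
      ... | no _ = inj₁ refl

      deg-pure : ∀ c → LS.ErrDegAtMost k c → G.ErrDegAtMost D (phaseState ℓ c c)
      deg-pure c deg =
        PhaseDegree.phaseState-deg i i≡ℓ ℓ<m c c (λ x → x) someVertex deg deg (λ _ _ → refl) (λ _ _ → inj₁ refl)

    -- Each local merge becomes a merge inside A_ℓ followed by the same merge inside B_ℓ.
    run : (∀ c → LS.Whole c → LS.ErrDegAtMost k c → G.SeqFrom D (phaseState ℓ c c)) →
          ∀ c → LS.SeqFrom k c → G.SeqFrom D (phaseState ℓ c c)
    run finish c (LS.done .c deg whole) = finish c whole deg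
    run finish c (LS.step .c c′ deg (a , b , a≢b , _ , _ , merged) rest) =
      LiftMerge.lift-merge {β = ℓ} a≢b
        (phaseState-atA ℓ<m c c) (atA⁻ c c) (phaseState-sameA ℓ c′ c c) (phaseState-atA ℓ<m c′ c)
        (λ v bv≡ℓ → merged v (inAB-atA i i≡ℓ v bv≡ℓ))
        (deg-pure c deg)
        (LiftMerge.lift-merge {β = m + ℓ} a≢b
          (phaseState-atB ℓ<m c′ c) (atB⁻ c′ c) (phaseState-sameB ℓ c′ c′ c) (phaseState-atB ℓ<m c′ c′)
          (λ v bv≡m+ℓ → merged v (inAB-atB i i≡ℓ v bv≡m+ℓ))
          (PhaseDegree.phaseState-deg i i≡ℓ ℓ<m c′ c (rename a b) b
            (LS.SeqFrom⇒ErrDegAtMost rest) deg merged (λ v _ → rename-fixes a b (c v)))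
          (run finish c′ rest))

    private
      ℓ<2m : ℓ < m + m
      ℓ<2m = <-≤-trans ℓ<m (m≤m+n m m)

      m+ℓ<2m : m + ℓ < m + m
      m+ℓ<2m = +-monoʳ-< m ℓ<m

      m+ℓ≢ℓ : m + ℓ ≢ ℓ
      m+ℓ≢ℓ e = <⇒≢ (subst (_< m + ℓ) (+-identityˡ ℓ) (+-monoˡ-< ℓ 0<m)) (sym e)

      inS : ∀ {j} → j ≡ ℓ ⊎ j ≡ m + ℓ → ∀ w → block w ≡ j → inAB m blk i w ≡ true
      inS (inj₁ refl) = inAB-atA i i≡ℓ
      inS (inj₂ refl) = inAB-atB i i≡ℓ

      whole-piece : ∀ cf → LS.Whole cf → ∀ {j} → j ≡ ℓ ⊎ j ≡ m + ℓ → ∀ v → block v ≡ j → pieceRep cf j (cf v) ≡ blockRep j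
      whole-piece cf whole {j} pair v bv≡j = first-cong _ _ someVertex same
        where
          same : ∀ w → ((block w ≡ᵇ j) ∧ (cf w == cf v)) ≡ (block w ≡ᵇ j)
          same w with block w ≡ᵇ j in bw≡ᵇj
          ... | false = refl
          ... | true = ≡⇒== (whole w v (inS pair w (≡ᵇ-true⇒≡ bw≡ᵇj)) (inS pair v bv≡j))

      singleton-piece : ∀ c₀ → LS.Singletons c₀ → ∀ {j} → j ≡ ℓ ⊎ j ≡ m + ℓ → ∀ v → block v ≡ j → pieceRep c₀ j (c₀ v) ≡ v
      singleton-piece c₀ alone pair v bv≡j = alone _ v (inS pair _ (proj₁ spec)) (inS pair v bv≡j) (proj₂ spec)
        where spec = pieceRep-spec c₀ v bv≡j refl

      whole-atA : ∀ cf → LS.Whole cf → ∀ v → block v ≡ ℓ → phaseState ℓ cf cf v ≡ blockRep ℓ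
      whole-atA cf whole v bv≡ℓ = trans (phaseState-atA ℓ<m cf cf v bv≡ℓ) (whole-piece cf whole (inj₁ refl) v bv≡ℓ)

      whole-atB : ∀ cf → LS.Whole cf → ∀ v → block v ≡ m + ℓ → phaseState ℓ cf cf v ≡ blockRep (m + ℓ)
      whole-atB cf whole v bv≡m+ℓ = trans (phaseState-atB ℓ<m cf cf v bv≡m+ℓ) (whole-piece cf whole (inj₂ refl) v bv≡m+ℓ)

      singleton-atA : ∀ c₀ → LS.Singletons c₀ → ∀ v → block v ≡ ℓ → phaseState ℓ c₀ c₀ v ≡ v
      singleton-atA c₀ alone v bv≡ℓ = trans (phaseState-atA ℓ<m c₀ c₀ v bv≡ℓ) (singleton-piece c₀ alone (inj₁ refl) v bv≡ℓ)

      singleton-atB : ∀ c₀ → LS.Singletons c₀ → ∀ v → block v ≡ m + ℓ → phaseState ℓ c₀ c₀ v ≡ v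
      singleton-atB c₀ alone v bv≡m+ℓ = trans (phaseState-atB ℓ<m c₀ c₀ v bv≡m+ℓ) (singleton-piece c₀ alone (inj₂ refl) v bv≡m+ℓ)

    start : ∀ c₀ → LS.Singletons c₀ → ∀ v → phaseState ℓ c₀ c₀ v ≡ collapsed ℓ ℓ v
    start c₀ alone v with position ℓ (block v)
    ... | belowA bv<ℓ = trans (phaseState-belowA ℓ<m c₀ c₀ v bv<ℓ) (sym (collapsed-mergedA (<⇒≤ ℓ<m) ≤-refl v bv<ℓ))
    ... | atA bv≡ℓ = trans (singleton-atA c₀ alone v bv≡ℓ)
                       (sym (collapsed-freeA (<⇒≤ ℓ<m) ≤-refl v (≤-reflexive (sym bv≡ℓ)) (subst (_< m) (sym bv≡ℓ) ℓ<m)))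
    ... | aboveA ℓ<bv bv<m = trans (phaseState-aboveA ℓ<m c₀ c₀ v ℓ<bv bv<m) (sym (collapsed-freeA (<⇒≤ ℓ<m) ≤-refl v (<⇒≤ ℓ<bv) bv<m))
    ... | belowB m≤bv bv<m+ℓ = trans (phaseState-belowB ℓ<m c₀ c₀ v m≤bv bv<m+ℓ) (sym (collapsed-mergedB (<⇒≤ ℓ<m) ≤-refl v m≤bv bv<m+ℓ))
    ... | atB bv≡m+ℓ = trans (singleton-atB c₀ alone v bv≡m+ℓ)
                         (sym (collapsed-freeB (<⇒≤ ℓ<m) ≤-refl v (≤-reflexive (sym bv≡m+ℓ))))
    ... | aboveB m+ℓ<bv = trans (phaseState-aboveB ℓ<m c₀ c₀ v m+ℓ<bv) (sym (collapsed-freeB (<⇒≤ ℓ<m) ≤-refl v (<⇒≤ m+ℓ<bv)))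

    private
      merge-A : ∀ cf → LS.Whole cf → ∀ v →
                collapsed (suc ℓ) ℓ v ≡ (if phaseState ℓ cf cf v == blockRep ℓ then hubA else phaseState ℓ cf cf v)
      merge-A cf whole v with position ℓ (block v)
      ... | belowA bv<ℓ rewrite phaseState-belowA ℓ<m cf cf v bv<ℓ =
        trans (collapsed-mergedA ℓ<m (n≤1+n ℓ) v (<-trans bv<ℓ (n<1+n ℓ))) (if-same _ hubA)
      ... | atA bv≡ℓ rewrite whole-atA cf whole v bv≡ℓ =
        trans (collapsed-mergedA ℓ<m (n≤1+n ℓ) v (subst (_< suc ℓ) (sym bv≡ℓ) (n<1+n ℓ))) (merged-self (blockRep ℓ) hubA)
      ... | aboveA ℓ<bv bv<m rewrite phaseState-aboveA ℓ<m cf cf v ℓ<bv bv<m =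
        trans (collapsed-freeA ℓ<m (n≤1+n ℓ) v ℓ<bv bv<m) (unmerged hubA λ e → >⇒≢ ℓ<bv (trans e (block-blockRep ℓ<2m)))
      ... | belowB m≤bv bv<m+ℓ rewrite phaseState-belowB ℓ<m cf cf v m≤bv bv<m+ℓ =
        trans (collapsed-mergedB ℓ<m (n≤1+n ℓ) v m≤bv bv<m+ℓ) (unmerged hubA λ e → <⇒≢ ℓ<m (sym (trans (sym block-hubB) (trans e (block-blockRep ℓ<2m)))))
      ... | atB bv≡m+ℓ rewrite whole-atB cf whole v bv≡m+ℓ =
        trans (collapsed-pending ℓ<m (n≤1+n ℓ) v (≤-reflexive (sym bv≡m+ℓ)) (subst (_< m + suc ℓ) (sym bv≡m+ℓ) (+-monoʳ-< m (n<1+n ℓ))))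
          (unmerged hubA λ e → m+ℓ≢ℓ (trans (sym (block-blockRep m+ℓ<2m)) (trans e (block-blockRep ℓ<2m))))
      ... | aboveB m+ℓ<bv rewrite phaseState-aboveB ℓ<m cf cf v m+ℓ<bv =
        trans (collapsed-freeB ℓ<m (n≤1+n ℓ) v (subst (_≤ block v) (sym (+-suc m ℓ)) m+ℓ<bv))
          (unmerged hubA λ e → <⇒≢ (≤-<-trans (m≤n+m ℓ m) m+ℓ<bv) (sym (trans e (block-blockRep ℓ<2m))))

      merge-B : ∀ v → collapsed (suc ℓ) (suc ℓ) v ≡
                      (if collapsed (suc ℓ) ℓ v == blockRep (m + ℓ) then hubB else collapsed (suc ℓ) ℓ v)
      merge-B v with block v <? suc ℓ
      ... | yes bv<1+ℓ rewrite collapsed-mergedA ℓ<m (n≤1+n ℓ) v bv<1+ℓ =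
        trans (collapsed-mergedA ℓ<m ≤-refl v bv<1+ℓ)
          (unmerged hubB λ e → <⇒≢ (<-≤-trans 0<m (m≤m+n m ℓ)) (trans (sym block-hubA) (trans e (block-blockRep m+ℓ<2m))))
      ... | no bv≮1+ℓ with position ℓ (block v)
      ...   | belowA bv<ℓ = ⊥-elim (bv≮1+ℓ (<-trans bv<ℓ (n<1+n ℓ)))
      ...   | atA bv≡ℓ = ⊥-elim (bv≮1+ℓ (subst (_< suc ℓ) (sym bv≡ℓ) (n<1+n ℓ)))
      ...   | aboveA ℓ<bv bv<m rewrite collapsed-freeA ℓ<m (n≤1+n ℓ) v ℓ<bv bv<m =
        trans (collapsed-freeA ℓ<m ≤-refl v ℓ<bv bv<m)
          (unmerged hubB λ e → <⇒≢ (<-≤-trans bv<m (m≤m+n m ℓ)) (trans e (block-blockRep m+ℓ<2m)))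
      ...   | belowB m≤bv bv<m+ℓ rewrite collapsed-mergedB ℓ<m (n≤1+n ℓ) v m≤bv bv<m+ℓ =
        trans (collapsed-mergedB ℓ<m ≤-refl v m≤bv (<-trans bv<m+ℓ (+-monoʳ-< m (n<1+n ℓ)))) (if-same _ hubB)
      ...   | atB bv≡m+ℓ
        rewrite collapsed-pending ℓ<m (n≤1+n ℓ) v (≤-reflexive (sym bv≡m+ℓ)) (subst (_< m + suc ℓ) (sym bv≡m+ℓ) (+-monoʳ-< m (n<1+n ℓ))) =
        trans (collapsed-mergedB ℓ<m ≤-refl v (subst (m ≤_) (sym bv≡m+ℓ) (m≤m+n m ℓ)) (subst (_< m + suc ℓ) (sym bv≡m+ℓ) (+-monoʳ-< m (n<1+n ℓ))))
          (merged-self (blockRep (m + ℓ)) hubB)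
      ...   | aboveB m+ℓ<bv rewrite collapsed-freeB ℓ<m (n≤1+n ℓ) v (subst (_≤ block v) (sym (+-suc m ℓ)) m+ℓ<bv) =
        trans (collapsed-freeB ℓ<m ≤-refl v (subst (_≤ block v) (sym (+-suc m ℓ)) m+ℓ<bv))
          (unmerged hubB λ e → >⇒≢ m+ℓ<bv (trans e (block-blockRep m+ℓ<2m)))

      hubA-kept : ∀ cf → LS.Whole cf → phaseState ℓ cf cf hubA ≡ hubA
      hubA-kept cf whole with m≤n⇒m<n∨m≡n (z≤n {ℓ})
      ... | inj₁ 0<ℓ = phaseState-belowA ℓ<m cf cf hubA (subst (_< ℓ) (sym block-hubA) 0<ℓ)
      ... | inj₂ 0≡ℓ = trans (whole-atA cf whole hubA (trans block-hubA 0≡ℓ)) (cong blockRep (sym 0≡ℓ))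

      hubB-kept : collapsed (suc ℓ) ℓ hubB ≡ hubB
      hubB-kept with m≤n⇒m<n∨m≡n (z≤n {ℓ})
      ... | inj₁ 0<ℓ = collapsed-mergedB ℓ<m (n≤1+n ℓ) hubB (≤-reflexive (sym block-hubB))
                         (subst (_< m + ℓ) (trans (+-identityʳ m) (sym block-hubB)) (+-monoʳ-< m 0<ℓ))
      ... | inj₂ refl = trans (collapsed-pending ℓ<m (n≤1+n ℓ) hubB (≤-reflexive (trans (+-identityʳ m) (sym block-hubB)))
                                (subst (_< m + 1) (sym block-hubB) (subst (m <_) (sym (+-comm m 1)) (n<1+n m))))
                              (cong blockRep (+-identityʳ m))

    finish : G.SeqFrom D (collapsed (suc ℓ) (suc ℓ)) →
             ∀ cf → LS.Whole cf → LS.ErrDegAtMost k cf → G.SeqFrom D (phaseState ℓ cf cf)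
    finish next cf whole deg =
      G.merge-or-stay hubA (blockRep ℓ) (deg-pure cf deg)
        (G.occurs⁺ _ hubA refl (hubA-kept cf whole)) (G.occurs⁺ _ (blockRep ℓ) refl (whole-atA cf whole (blockRep ℓ) (block-blockRep ℓ<2m)))
        (λ v _ → merge-A cf whole v)
        (G.merge-or-stay hubB (blockRep (m + ℓ)) (CollapsedDegree.collapsed-deg ℓ<m (n≤1+n ℓ) ≤-refl)
          (G.occurs⁺ _ hubB refl hubB-kept)
          (G.occurs⁺ _ (blockRep (m + ℓ)) refl
            (collapsed-pending ℓ<m (n≤1+n ℓ) (blockRep (m + ℓ)) (≤-reflexive (sym (block-blockRep m+ℓ<2m)))
              (subst (_< m + suc ℓ) (sym (block-blockRep m+ℓ<2m)) (+-monoʳ-< m (n<1+n ℓ)))))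
          (λ v _ → merge-B v)
          next)

  collapsed-0-0 : ∀ v → collapsed 0 0 v ≡ v
  collapsed-0-0 v with block v <? m
  ... | yes bv<m = collapsed-freeA z≤n z≤n v z≤n bv<m
  ... | no bv≮m = collapsed-freeB z≤n z≤n v (subst (_≤ block v) (sym (+-identityʳ m)) (≮⇒≥ bv≮m))

  collapsed-m-m : G.SeqFrom D (collapsed m m)
  collapsed-m-m =
    G.merge-or-stay hubA hubB (CollapsedDegree.collapsed-deg ≤-refl ≤-refl (n≤1+n m))
      (G.occurs⁺ _ hubA refl (collapsed-mergedA ≤-refl ≤-refl hubA (subst (_< m) (sym block-hubA) 0<m)))
      (G.occurs⁺ _ hubB refl (collapsed-mergedB ≤-refl ≤-refl hubB (≤-reflexive (sym block-hubB))
        (subst (_< m + m) (sym block-hubB) (subst (_< m + m) (+-identityʳ m) (+-monoʳ-< m 0<m)))))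
      merge
      (G.done (λ _ → hubA) one-part (λ _ _ _ _ → refl))
    where
      merge : ∀ v → true ≡ true → hubA ≡ (if collapsed m m v == hubB then hubA else collapsed m m v)
      merge v _ with block v <? m
      ... | yes bv<m rewrite collapsed-mergedA ≤-refl ≤-refl v bv<m = if-same _ hubA
      ... | no bv≮m rewrite collapsed-mergedB ≤-refl ≤-refl v (≮⇒≥ bv≮m) (block<2m v) = merged-self hubB hubA
      one-part : G.ErrDegAtMost D (λ _ → hubA)
      one-part a occ = ≤-trans (G.errDeg-≤ _ a [] λ b ob a≢b _ → ⊥-elim (a≢b (trans (sym (label occ)) (label ob)))) z≤n
        where
          label : ∀ {c} → G.occurs (λ _ → hubA) c ≡ true → hubA ≡ c
          label {c} o = proj₂ (proj₂ (G.occurs⁻ _ c o))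

  module _ (local : ∀ i → twwInducedAtMost (inAB m blk i) E k) where

    collapsed-seq : ∀ r ℓ → ℓ + r ≡ m → G.SeqFrom D (collapsed ℓ ℓ)
    collapsed-seq zero ℓ ℓ+0≡m with refl ← trans (sym (+-identityʳ ℓ)) ℓ+0≡m = collapsed-m-m
    collapsed-seq (suc r) ℓ ℓ+1+r≡m =
      G.SeqFrom-resp (λ v _ → Phase.start i i≡ℓ ℓ<m c₀ alone v)
        (Phase.run i i≡ℓ ℓ<m (Phase.finish i i≡ℓ ℓ<m next) c₀ seq)
      where
        ℓ<m : ℓ < m
        ℓ<m = subst (ℓ <_) ℓ+1+r≡m (m<m+n ℓ (s≤s z≤n))
        i : Fin m
        i = fromℕ< ℓ<m
        i≡ℓ : toℕ i ≡ ℓ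
        i≡ℓ = toℕ-fromℕ< ℓ<m
        c₀ : Fin n → Fin n
        c₀ = proj₁ (local i)
        alone : L.Singletons i c₀
        alone = proj₁ (proj₂ (local i))
        seq : L.SeqFrom i k c₀
        seq = proj₂ (proj₂ (local i))
        next : G.SeqFrom D (collapsed (suc ℓ) (suc ℓ))
        next = collapsed-seq r (suc ℓ) (trans (sym (+-suc ℓ r)) ℓ+1+r≡m)

    tww≤D : twwAtMost E D
    tww≤D =
      collapsed 0 0 ,
      (λ u v _ _ same → trans (sym (collapsed-0-0 u)) (trans same (collapsed-0-0 v))) ,
      collapsed-seq m 0 refl

lemma11 : (n m k : ℕ) (E : Fin n → Fin n → Bool) (blk : Fin n → Fin (m + m)) →
    (∀ u v → E u v ≡ E v u) →
    (∀ v → E v v ≡ false) →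
    (∀ u v → toℕ u ≤ toℕ v → toℕ (blk u) ≤ toℕ (blk v)) →
    (∀ j → Σ (Fin n) λ v → blk v ≡ j) →
    (∀ u v → E u v ≡ true →
      Σ (Fin m) λ i → (inA m blk i u ≡ true × inB m blk i v ≡ true)
                    ⊎ (inB m blk i u ≡ true × inA m blk i v ≡ true)) →
    (∀ i → twwInducedAtMost (inAB m blk i) E k) →
    twwAtMost E (2 * k + 2)
lemma11 zero zero k E blk _ _ _ _ _ _ = (λ v → v) , (λ ()) , TwinWidth.done (λ v → v) (λ ()) (λ ())
lemma11 (suc n) zero k E blk _ _ _ _ _ _ with () ← blk Data.Fin.Base.zero
lemma11 n (suc m) k E blk E-sym _ blk-mono blk-surj edges local =
  Construction.tww≤D n (suc m) k E blk E-sym blk-mono blk-surj edges (s≤s z≤n) local
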